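{- Let $s\ge1$, $t\ge0$, let $C_1,\ldots,C_s$ be generating matrices of an order 2 digital $(t,s)$-sequence over $\mathbb{F}_2$, and let $N\ge2$ with $N=2^{m_1}+\cdots+2^{m_r}$, $m_1>\cdots>m_r\ge0$. Then there is a constant $C>0$ depending only on $s$ and $t$ such that for every $\boldsymbol{b}\in\mathbb{N}_0^s$ $$\sum_{h=1}^r2^{m_h-|\boldsymbol{b}|_1}\sum_{\boldsymbol{\ell}\in B(\boldsymbol{b})}\sum_{\substack{\boldsymbol{z}\in\mathbb{N}_0^s\\ \boldsymbol{\ell}\oplus\lfloor2^{\boldsymbol{z}+\nu(\boldsymbol{\ell})-\boldsymbol{1}}\rfloor\in\mathcal{D}^\ast_{m_h,s}}}2^{ -|\boldsymbol{z}|_1}\le C\,r.$$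
   Context: Order 2 digital $(t,s)$-sequence over $\mathbb{F}_2$: generating matrices $C_j=(c_{j,k,\ell})\in\mathbb{F}_2^{\mathbb{N}\times\mathbb{N}}$ with $c_{j,k,\ell}=0$ for $k>2\ell$ such that for all $m>t/2$ the upper-left submatrices $C_j^{2m\times m}$, with rows $c_{j,1},\ldots,c_{j,2m}$, satisfy: for all $\nu_j\ge0$ and $1\le i_{j,\nu_j}<\cdots<i_{j,1}\le2m$ with $\sum_j\sum_{l=1}^{\min(\nu_j,2)}i_{j,l}\le2m-t$ the rows $c_{j,i_{j,l}}$ are linearly independent over $\mathbb{F}_2$. $\mu_1(0)=0$, $\mu_1(k)=1+\lfloor\log_2k\rfloor$ for $k\ge1$; $\nu(\boldsymbol{\ell})=(\mu_1(\ell_j))_j$; $B(\boldsymbol{b})=\{\boldsymbol{\ell}\in\mathbb{N}_0^s:\mu_1(\ell_j)=b_j\ \forall j\}$; $|\boldsymbol{v}|_1=\sum_jv_j$. $\oplus$: digitwise addition mod 2 of binary expansions of nonnegative integers; $\boldsymbol{\ell}\oplus\lfloor2^{\boldsymbol{z}+\nu(\boldsymbol{\ell})-\boldsymbol{1}}\rfloor$ has $j$th entry $\ell_j\oplus\lfloor2^{z_j+\mu_1(\ell_j)-1}\rfloor$. Dual net: for $m\ge0$ and $k\in\mathbb{N}_0$ with binary digits $\kappa_0,\kappa_1,\ldots$ let $\vec{k}=(\kappa_0,\ldots,\kappa_{2m-1})^\top\in\mathbb{F}_2^{2m}$; $\mathcal{D}_{m,s}=\{\boldsymbol{k}\in\mathbb{N}_0^s:\sum_{j=1}^s(C_j^{2m\times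 m})^\top\vec{k}_j=\vec{0}\in\mathbb{F}_2^m\}$ and $\mathcal{D}^\ast_{m,s}=\mathcal{D}_{m,s}\setminus\{\boldsymbol{0}\}$. -}

module Defs where

open import Data.Bool using (Bool; true; false; _xor_; _∧_; not; if_then_else_)
open import Data.Nat using (ℕ; zero; suc; _+_; _*_; _∸_; _^_; _≤_; _<_; _≡ᵇ_; ⌊_/2⌋; _%_)
open import Data.Nat.Logarithm using (⌊log₂_⌋)
open import Data.Fin using (Fin)
import Data.Fin
open import Data.Vec.Functional using () renaming (_∷_ to _∷ᵥ_)
open import Data.List using (List; []; _∷_; length; map; sum)
open import Data.List.Relation.Unary.Linked using (Linked)
open import Data.Integer using (+_)
open import Data.Product using (_×_; Σ)
open import Relation.Binary.PropositionalEquality using (_≡_)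
import Data.Rational as ℚ
open ℚ using (ℚ; 0ℚ; 1ℚ; ½)

sumℕ : ℕ → (ℕ → ℕ) → ℕ
sumℕ zero    f = 0
sumℕ (suc n) f = sumℕ n f + f n

sumFinℕ : (s : ℕ) → (Fin s → ℕ) → ℕ
sumFinℕ zero    f = 0
sumFinℕ (suc s) f = f Data.Fin.zero + sumFinℕ s (λ j → f (Data.Fin.suc j))

xsum : ℕ → (ℕ → Bool) → Bool
xsum zero    f = false
xsum (suc n) f = xsum n f xor f n

xsumFin : (s : ℕ) → (Fin s → Bool) → Bool
xsumFin zero    f = false
xsumFin (suc s) f = f Data.Fin.zero xor xsumFin s (λ j → f (Data.Fin.suc j))

sumℚ : ℕ → (ℕ → ℚ) → ℚ
sumℚ zero    f = 0ℚ
sumℚ (suc n) f = sumℚ n f ℚ.+ f n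

sumBox : (s : ℕ) → ℕ → ((Fin s → ℕ) → ℚ) → ℚ
sumBox zero    L f = f (λ ())
sumBox (suc s) L f = sumℚ L (λ x → sumBox s L (λ v → f (x ∷ᵥ v)))

-- bit k i = κ_i, the i-th binary digit of k (κ_0 least significant)
bit : ℕ → ℕ → Bool
bit k zero    = (k % 2) ≡ᵇ 1
bit k (suc i) = bit ⌊ k /2⌋ i

-- a ⊕ b : digitwise addition mod 2 (a + b + 1 digits suffice)
_⊕_ : ℕ → ℕ → ℕ
a ⊕ b = sumℕ (suc (a + b)) (λ i → if bit a i xor bit b i then 2 ^ i else 0)

μ₁ : ℕ → ℕ
μ₁ zero    = 0
μ₁ (suc k) = suc ⌊log₂ suc k ⌋

-- ⌊2^(e - 1)⌋ for e ∈ ℕ (equals 0 when e = 0, since ⌊2^{-1}⌋ = 0)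
floorPow2pred : ℕ → ℕ
floorPow2pred zero    = 0
floorPow2pred (suc e) = 2 ^ e

pow2 : ℕ → ℚ
pow2 k = (+ (2 ^ k)) ℚ./ 1

pow2neg : ℕ → ℚ
pow2neg zero    = 1ℚ
pow2neg (suc k) = ½ ℚ.* pow2neg k

-- Generating matrices over 𝔽₂ (0-based indices):
--   C j k l  is  c_{j,k+1,l+1}  (row k+1, column l+1 of C_{j+1}).
Matrices : ℕ → Set
Matrices s = Fin s → ℕ → ℕ → Bool

-- Sum of the min(p, #) largest elements of {i+1 : i < n, S i = true}
-- (the 1-based row indices selected by S among rows 1..n).
topSum : ℕ → (ℕ → Bool) → ℕ → ℕ
topSum zero    S n       = 0
topSum (suc p) S zero    = 0
topSum (suc p) S (suc n) = if S n then suc n + topSum p S n else topSum (suc p) S n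

RowsLinIndep : {s : ℕ} → Matrices s → ℕ → (Fin s → ℕ → Bool) → Set
RowsLinIndep {s} C m S =
  (a : Fin s → ℕ → Bool) →
  (∀ j i → i < 2 * m → a j i ≡ true → S j i ≡ true) →
  (∀ col → col < m →
     xsumFin s (λ j → xsum (2 * m) (λ i → a j i ∧ C j i col)) ≡ false) →
  ∀ j i → i < 2 * m → a j i ≡ false

-- A choice of rows 1 ≤ i_{j,ν_j} < … < i_{j,1} ≤ 2m for each j is a subset
-- S j of {1,…,2m} (0-based: S j i for i < 2m); ν_j = its size, and
-- Σ_{l=1}^{min(ν_j,2)} i_{j,l} is the sum of its two largest elements.
IsOrder2DigitalSeq : (s t : ℕ) → Matrices s → Set
IsOrder2DigitalSeq s t C =
  (∀ j k l → suc (2 * l) < k → C j k l ≡ false)   -- c_{j,k,ℓ} = 0 for k > 2ℓ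
  × (∀ m → t < 2 * m →
       (S : Fin s → ℕ → Bool) →
       sumFinℕ s (λ j → topSum 2 (S j) (2 * m)) + t ≤ 2 * m →
       RowsLinIndep C m S)

-- Dual net (membership as a computable 𝔽₂-predicate, needed to form sums)

allBelow : ℕ → (ℕ → Bool) → Bool
allBelow zero    f = true
allBelow (suc n) f = allBelow n f ∧ f n

allFinᵇ : (s : ℕ) → (Fin s → Bool) → Bool
allFinᵇ zero    f = true
allFinᵇ (suc s) f = f Data.Fin.zero ∧ allFinᵇ s (λ j → f (Data.Fin.suc j))

-- k ∈ 𝒟_{m,s} :  Σ_j (C_j^{2m×m})ᵀ k⃗_j = 0 ∈ 𝔽₂^m, where
-- k⃗_j = (κ_0,…,κ_{2m-1}) are the first 2m binary digits of k_j.
inDualᵇ : {s : ℕ} → Matrices s → ℕ → (Fin s → ℕ) → Bool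
inDualᵇ {s} C m k =
  allBelow m (λ col →
    not (xsumFin s (λ j → xsum (2 * m) (λ i → bit (k j) i ∧ C j i col))))

inDualStarᵇ : {s : ℕ} → Matrices s → ℕ → (Fin s → ℕ) → Bool
inDualStarᵇ {s} C m k = inDualᵇ C m k ∧ not (allFinᵇ s (λ j → k j ≡ᵇ 0))

inBᵇ : {s : ℕ} → (Fin s → ℕ) → (Fin s → ℕ) → Bool
inBᵇ {s} b ℓ = allFinᵇ s (λ j → μ₁ (ℓ j) ≡ᵇ b j)

norm1 : {s : ℕ} → (Fin s → ℕ) → ℕ
norm1 {s} v = sumFinℕ s v

-- Truncated inner double sum (ℓ and z restricted to the box {0,…,L-1}^s):
--   Σ_{ℓ ∈ B(b)} Σ_{z : ℓ ⊕ ⌊2^{z+ν(ℓ)-1}⌋ ∈ 𝒟*_{m,s}} 2^{-|z|₁}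
innerSum : {s : ℕ} → Matrices s → ℕ → (Fin s → ℕ) → ℕ → ℚ
innerSum {s} C m b L =
  sumBox s L (λ ℓ →
    if inBᵇ b ℓ
    then sumBox s L (λ z →
           if inDualStarᵇ C m (λ j → ℓ j ⊕ floorPow2pred (z j + μ₁ (ℓ j)))
           then pow2neg (norm1 z) else 0ℚ)
    else 0ℚ)

outerSum : {s : ℕ} → Matrices s → List ℕ → (Fin s → ℕ) → ℕ → ℚ
outerSum C []       b L = 0ℚ
outerSum C (m ∷ ms) b L =
  (pow2 m ℚ.* pow2neg (norm1 b)) ℚ.* innerSum C m b L ℚ.+ outerSum C ms b L

-- Each summand h of the sum is at most 2^t · 4^s, so C = 2^t · 4^s works. Fix m = m_h and z, and call ℓ ∈ B(b) admissible when its
-- dual index k = ℓ ⊕ ⌊2^{z+ν(ℓ)-1}⌋ lies in 𝒟*_{m,s}. The digits of k_j lie below b_j,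
-- except one at position z_j + b_j - 1, so the order 2 property forces k = 0 unless
-- 2m ≤ |z|₁ + 2|b|₁ + t. In that case pin down |b|₁ ⊓ (m ∸ t) low digits of ℓ: the
-- digitwise difference of the dual indices of two admissible ℓ with the same high digits
-- involves only these rows, so by the order 2 property again the high digits determine ℓ,
-- and at most 2^{|b|₁ - |b|₁ ⊓ (m ∸ t)} of the ℓ are admissible. This makes the weight
-- 2^{m-|b|₁-|z|₁} · #{admissible ℓ} at most 2^t (3/4)^{|z|₁}, and Σ_z (3/4)^{|z|₁} ≤ 4^s.

module Submission where

open import Defs
open import Data.Nat using (ℕ; _+_; _^_; _≤_; _<_; _>_)
open import Data.Fin using (Fin)
import Data.Fin as Fin
open import Data.List using (List; length; map)
open import Data.Nat.ListAction using (sum)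
open import Data.List.Relation.Unary.Linked using (Linked)
open import Data.Product using (Σ; _×_)
open import Data.Integer using (+_)
open import Relation.Binary.PropositionalEquality using (_≡_)
open import Data.Rational using (ℚ; 0ℚ; _/_; _*_) renaming (_<_ to _<ℚ_; _≤_ to _≤ℚ_)

open import Data.List using ([]; _∷_)
open import Data.Nat using (zero; suc; _∸_; _⊓_; ⌊_/2⌋; _%_; _≡ᵇ_; z≤n; s≤s; _<?_; _≤?_)
import Data.Nat as ℕ
import Data.Nat.Properties as ℕₚ
open import Data.Nat.DivMod using ([m+n]%n≡m%n)
open import Data.Nat.Logarithm using (⌊log₂_⌋; ⌊log₂⌋-mono-≤; ⌊log₂[2^n]⌋≡n)
open import Data.Nat.Tactic.RingSolver using (solve-∀)
open import Data.Bool using (Bool; true; false; _xor_; _∧_; not; if_then_else_; T)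
open import Data.Empty using (⊥-elim)
open import Data.Sum using (_⊎_; inj₁; inj₂)
open import Data.Product using (_,_; proj₁; proj₂)
open import Relation.Binary.PropositionalEquality
  using (refl; sym; trans; cong; cong₂; subst; module ≡-Reasoning)
open import Relation.Nullary using (¬_; yes; no)
open import Data.Vec.Functional using () renaming (_∷_ to _∷ᵥ_)
open import Data.Rational using (1ℚ; ½)
import Data.Rational as ℚ
import Data.Rational.Properties as ℚₚ
open import Data.Rational.Solver using (module +-*-Solver)
import Data.Nat.Coprimality as Coprimality
import Data.Integer as ℤ
import Data.Integer.Properties as ℤₚ
open import Algebra.Bundles using (CommutativeRing; CommutativeMonoid)
import Algebra.Properties.CommutativeSemigroup as CommutativeSemigroupProperties
open import Data.Bool.Properties
  using (xor-∧-commutativeRing; ∧-distribʳ-xor; ∧-conicalˡ; ∧-conicalʳ; not-injective; xor-same; xor-identityʳ)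

module ℕ+ = CommutativeSemigroupProperties ℕₚ.+-commutativeSemigroup
module ℚ+ = CommutativeSemigroupProperties (CommutativeMonoid.commutativeSemigroup ℚₚ.+-0-commutativeMonoid)
module 𝔽₂+ = CommutativeSemigroupProperties (CommutativeRing.+-commutativeSemigroup xor-∧-commutativeRing)

-- Binary digits

bit-zero : ∀ i → bit 0 i ≡ false
bit-zero zero    = refl
bit-zero (suc i) = bit-zero i

bit0-2+ : ∀ y → bit (2 + y) 0 ≡ bit y 0
bit0-2+ y = cong (_≡ᵇ 1) (trans (cong (_% 2) (ℕₚ.+-comm 2 y)) ([m+n]%n≡m%n y 2))

+-double-suc : ∀ x w → x + (suc w + suc w) ≡ 2 + (x + (w + w))
+-double-suc = solve-∀

bit0-+-double : ∀ x w → bit (x + (w + w)) 0 ≡ bit x 0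
bit0-+-double x zero    = cong (λ y → bit y 0) (ℕₚ.+-identityʳ x)
bit0-+-double x (suc w) =
  trans (cong (λ y → bit y 0) (+-double-suc x w)) (trans (bit0-2+ (x + (w + w))) (bit0-+-double x w))

⌊/2⌋-+-double : ∀ x w → ⌊ x + (w + w) /2⌋ ≡ ⌊ x /2⌋ + w
⌊/2⌋-+-double x zero    = trans (cong ⌊_/2⌋ (ℕₚ.+-identityʳ x)) (sym (ℕₚ.+-identityʳ _))
⌊/2⌋-+-double x (suc w) =
  trans (cong ⌊_/2⌋ (+-double-suc x w)) (trans (cong suc (⌊/2⌋-+-double x w)) (sym (ℕₚ.+-suc _ w)))

2^suc-* : ∀ n y → 2 ^ suc n ℕ.* y ≡ 2 ^ n ℕ.* y + 2 ^ n ℕ.* y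
2^suc-* n y = trans (ℕₚ.*-assoc 2 (2 ^ n) y) (cong (λ w → 2 ^ n ℕ.* y + w) (ℕₚ.+-identityʳ _))

⌊/2⌋-+-2^suc-* : ∀ n x y → ⌊ x + 2 ^ suc n ℕ.* y /2⌋ ≡ ⌊ x /2⌋ + 2 ^ n ℕ.* y
⌊/2⌋-+-2^suc-* n x y =
  trans (cong (λ w → ⌊ x + w /2⌋) (2^suc-* n y)) (⌊/2⌋-+-double x (2 ^ n ℕ.* y))

⌊/2⌋-<-2^ : ∀ n x → x < 2 ^ suc n → ⌊ x /2⌋ < 2 ^ n
⌊/2⌋-<-2^ n x x<2^1+n = ℕₚ.≰⇒> λ 2^n≤ → ℕₚ.<⇒≱ x<2^1+n (begin
  2 ^ suc n              ≡⟨ cong (λ w → 2 ^ n + w) (ℕₚ.+-identityʳ (2 ^ n)) ⟩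
  2 ^ n + 2 ^ n          ≤⟨ ℕₚ.+-mono-≤ 2^n≤ (ℕₚ.≤-trans 2^n≤ (ℕₚ.⌊n/2⌋≤⌈n/2⌉ x)) ⟩
  ⌊ x /2⌋ + ℕ.⌈ x /2⌉    ≡⟨ ℕₚ.⌊n/2⌋+⌈n/2⌉≡n x ⟩
  x                      ∎)
  where open ℕₚ.≤-Reasoning

bit-low : ∀ n x y i → x < 2 ^ n → i < n → bit (x + 2 ^ n ℕ.* y) i ≡ bit x i
bit-low (suc n) x y zero    _   _         =
  trans (cong (λ w → bit (x + w) 0) (2^suc-* n y)) (bit0-+-double x (2 ^ n ℕ.* y))
bit-low (suc n) x y (suc i) x<2^n (s≤s i<n) =
  trans (cong (λ w → bit w i) (⌊/2⌋-+-2^suc-* n x y)) (bit-low n ⌊ x /2⌋ y i (⌊/2⌋-<-2^ n x x<2^n) i<n)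

bit-high : ∀ n x y i → x < 2 ^ n → bit (x + 2 ^ n ℕ.* y) (n + i) ≡ bit y i
bit-high zero    zero    y i _           = cong (λ w → bit w i) (ℕₚ.+-identityʳ y)
bit-high zero    (suc x) y i (s≤s ())
bit-high (suc n) x       y i x<2^n =
  trans (cong (λ w → bit w (n + i)) (⌊/2⌋-+-2^suc-* n x y)) (bit-high n ⌊ x /2⌋ y i (⌊/2⌋-<-2^ n x x<2^n))

bit-≥ : ∀ n x i → x < 2 ^ n → n ≤ i → bit x i ≡ false
bit-≥ n x i x<2^n n≤i = begin
  bit x i                          ≡⟨ cong₂ bit (sym x+2^n*0≡x) (sym (ℕₚ.m+[n∸m]≡n n≤i)) ⟩
  bit (x + 2 ^ n ℕ.* 0) (n + (i ∸ n)) ≡⟨ bit-high n x 0 (i ∸ n) x<2^n ⟩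
  bit 0 (i ∸ n)                    ≡⟨ bit-zero (i ∸ n) ⟩
  false                            ∎
  where
  open ≡-Reasoning
  x+2^n*0≡x : x + 2 ^ n ℕ.* 0 ≡ x
  x+2^n*0≡x = trans (cong (λ w → x + w) (ℕₚ.*-zeroʳ (2 ^ n))) (ℕₚ.+-identityʳ x)

bit-block : ∀ d q r i → r < 2 ^ d → d ≤ i → bit (q ℕ.* 2 ^ d + r) i ≡ bit q (i ∸ d)
bit-block d q r i r<2^d d≤i = begin
  bit (q ℕ.* 2 ^ d + r) i               ≡⟨ cong₂ bit (trans (ℕₚ.+-comm _ r) (cong (λ w → r + w) (ℕₚ.*-comm q (2 ^ d))))
                                                     (sym (ℕₚ.m+[n∸m]≡n d≤i)) ⟩
  bit (r + 2 ^ d ℕ.* q) (d + (i ∸ d))   ≡⟨ bit-high d r q (i ∸ d) r<2^d ⟩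
  bit q (i ∸ d)                         ∎
  where open ≡-Reasoning

bit-true⇒< : ∀ n x i → x < 2 ^ n → bit x i ≡ true → i < n
bit-true⇒< n x i x<2^n bit≡true with i <? n
... | yes i<n = i<n
... | no  i≮n with () ← trans (sym bit≡true) (bit-≥ n x i x<2^n (ℕₚ.≮⇒≥ i≮n))

digit : Bool → ℕ
digit b = if b then 1 else 0

bit0-digit : ∀ b → bit (digit b) 0 ≡ b
bit0-digit true  = refl
bit0-digit false = refl

digit+double : ∀ x → digit (bit x 0) + (⌊ x /2⌋ + ⌊ x /2⌋) ≡ x
digit+double zero          = refl
digit+double (suc zero)    = refl
digit+double (suc (suc y)) = begin
  digit (bit (2 + y) 0) + (suc ⌊ y /2⌋ + suc ⌊ y /2⌋)
    ≡⟨ cong (λ b → digit b + (suc ⌊ y /2⌋ + suc ⌊ y /2⌋)) (bit0-2+ y) ⟩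
  digit (bit y 0) + (suc ⌊ y /2⌋ + suc ⌊ y /2⌋)
    ≡⟨ +-double-suc (digit (bit y 0)) ⌊ y /2⌋ ⟩
  2 + (digit (bit y 0) + (⌊ y /2⌋ + ⌊ y /2⌋))
    ≡⟨ cong (λ w → 2 + w) (digit+double y) ⟩
  2 + y
    ∎
  where open ≡-Reasoning

bit-injective : ∀ {x y} → (∀ i → bit x i ≡ bit y i) → x ≡ y
bit-injective {x} {y} = bounded (x + y) (ℕₚ.m≤m+n x y) (ℕₚ.m≤n+m y x)
  where
  ⌊/2⌋-≤ : ∀ n x → x ≤ suc n → ⌊ x /2⌋ ≤ n
  ⌊/2⌋-≤ n x x≤1+n = ℕₚ.≤-pred (ℕₚ.≤-trans (s≤s (ℕₚ.⌊n/2⌋-mono x≤1+n)) (ℕₚ.⌊n/2⌋<n n))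
  bounded : ∀ n {x y} → x ≤ n → y ≤ n → (∀ i → bit x i ≡ bit y i) → x ≡ y
  bounded zero    z≤n z≤n _        = refl
  bounded (suc n) {x} {y} x≤ y≤ same = begin
    x                                               ≡⟨ sym (digit+double x) ⟩
    digit (bit x 0) + (⌊ x /2⌋ + ⌊ x /2⌋)           ≡⟨ cong₂ (λ b w → digit b + (w + w)) (same 0) halves ⟩
    digit (bit y 0) + (⌊ y /2⌋ + ⌊ y /2⌋)           ≡⟨ digit+double y ⟩
    y                                               ∎
    where
    open ≡-Reasoning
    halves : ⌊ x /2⌋ ≡ ⌊ y /2⌋
    halves = bounded n (⌊/2⌋-≤ n x x≤) (⌊/2⌋-≤ n y y≤) (λ i → same (suc i))

fromBits : (ℕ → Bool) → ℕ → ℕ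
fromBits c n = sumℕ n (λ i → if c i then 2 ^ i else 0)

if-2^≡2^*digit : ∀ b n → (if b then 2 ^ n else 0) ≡ 2 ^ n ℕ.* digit b
if-2^≡2^*digit true  n = sym (ℕₚ.*-identityʳ (2 ^ n))
if-2^≡2^*digit false n = sym (ℕₚ.*-zeroʳ (2 ^ n))

fromBits-< : ∀ c n → fromBits c n < 2 ^ n
fromBits-< c zero    = s≤s z≤n
fromBits-< c (suc n) = begin-strict
  fromBits c n + (if c n then 2 ^ n else 0) <⟨ ℕₚ.+-mono-<-≤ (fromBits-< c n) (if≤ (c n)) ⟩
  2 ^ n + 2 ^ n                              ≡⟨ cong (λ w → 2 ^ n + w) (sym (ℕₚ.+-identityʳ (2 ^ n))) ⟩
  2 ^ suc n                                  ∎
  where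
  open ℕₚ.≤-Reasoning
  if≤ : ∀ b → (if b then 2 ^ n else 0) ≤ 2 ^ n
  if≤ true  = ℕₚ.≤-refl
  if≤ false = z≤n

bit-fromBits : ∀ c n i → i < n → bit (fromBits c n) i ≡ c i
bit-fromBits c (suc n) i i<1+n rewrite if-2^≡2^*digit (c n) n with ℕₚ.m<1+n⇒m<n∨m≡n i<1+n
... | inj₁ i<n  = trans (bit-low n (fromBits c n) (digit (c n)) i (fromBits-< c n) i<n) (bit-fromBits c n i i<n)
... | inj₂ refl = trans (cong (bit _) (sym (ℕₚ.+-identityʳ i)))
                        (trans (bit-high i (fromBits c i) (digit (c i)) 0 (fromBits-< c i)) (bit0-digit (c i)))

n<2^n : ∀ n → n < 2 ^ n
n<2^n zero    = s≤s z≤n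
n<2^n (suc n) = ℕₚ.<-≤-trans (s≤s (n<2^n n))
  (ℕₚ.≤-trans (ℕₚ.+-monoˡ-≤ (2 ^ n) (ℕₚ.m^n>0 2 n))
              (ℕₚ.≤-reflexive (cong (λ w → 2 ^ n + w) (sym (ℕₚ.+-identityʳ (2 ^ n))))))

bit-⊕ : ∀ a b i → bit (a ⊕ b) i ≡ bit a i xor bit b i
bit-⊕ a b i with i <? suc (a + b)
... | yes i<n = bit-fromBits (λ j → bit a j xor bit b j) (suc (a + b)) i i<n
... | no  i≮n = begin
  bit (a ⊕ b) i           ≡⟨ bit-≥ n (a ⊕ b) i (fromBits-< _ n) n≤i ⟩
  false                   ≡⟨ sym (cong₂ _xor_ (bit-≥ n a i (below a (ℕₚ.m≤m+n a b)) n≤i)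
                                              (bit-≥ n b i (below b (ℕₚ.m≤n+m b a)) n≤i)) ⟩
  bit a i xor bit b i     ∎
  where
  open ≡-Reasoning
  n = suc (a + b)
  n≤i = ℕₚ.≮⇒≥ i≮n
  below : ∀ x → x ≤ a + b → x < 2 ^ n
  below x x≤ = ℕₚ.<-≤-trans (n<2^n x) (ℕₚ.^-monoʳ-≤ 2 (ℕₚ.≤-trans x≤ (ℕₚ.n≤1+n _)))

bit-2^ : ∀ e i → bit (2 ^ e) i ≡ true → i ≡ e
bit-2^ e i bit≡true = digitAt (subst (λ x → bit x i ≡ true) (sym (ℕₚ.*-identityʳ (2 ^ e))) bit≡true)
  where
  digitAt : bit (0 + 2 ^ e ℕ.* 1) i ≡ true → i ≡ e
  digitAt h with i <? e
  ... | yes i<e with () ← trans (sym h) (trans (bit-low e 0 1 i (ℕₚ.m^n>0 2 e) i<e) (bit-zero i))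
  digitAt h | no i≮e with ℕₚ.m≤n⇒∃[o]m+o≡n (ℕₚ.≮⇒≥ i≮e)
  ... | zero  , e+0≡i = trans (sym e+0≡i) (ℕₚ.+-identityʳ e)
  ... | suc o , refl with () ← trans (sym h) (trans (bit-high e 0 1 (suc o) (ℕₚ.m^n>0 2 e)) (bit-zero o))

<2^μ₁ : ∀ x → x < 2 ^ μ₁ x
<2^μ₁ zero    = s≤s z≤n
<2^μ₁ (suc k) = ℕₚ.≰⇒> λ 2^μ₁≤ → ℕₚ.<⇒≱ (ℕₚ.n<1+n ⌊log₂ suc k ⌋)
  (ℕₚ.≤-trans (ℕₚ.≤-reflexive (sym (⌊log₂[2^n]⌋≡n (μ₁ (suc k))))) (⌊log₂⌋-mono-≤ 2^μ₁≤))

bit-floorPow2pred : ∀ e i → bit (floorPow2pred e) i ≡ true → suc i ≡ e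
bit-floorPow2pred zero    i h with () ← trans (sym h) (bit-zero i)
bit-floorPow2pred (suc e) i h = cong suc (bit-2^ e i h)

bit-⊕-floorPow2pred : ∀ c e x i → x < 2 ^ c →
  bit (x ⊕ floorPow2pred e) i ≡ true → suc i ≡ e ⊎ i < c
bit-⊕-floorPow2pred c e x i x<2^c h with bit x i in bx | bit (floorPow2pred e) i in bp
... | true  | _    = inj₂ (bit-true⇒< c x i x<2^c bx)
... | false | true = inj₁ (bit-floorPow2pred e i bp)
... | false | false with () ← trans (sym h) (trans (bit-⊕ x _ i) (cong₂ _xor_ bx bp))

topSum1-≤ : ∀ S n q → (∀ i → i < n → S i ≡ true → i < q) → topSum 1 S n ≤ q
topSum1-≤ S zero    q _ = z≤n
topSum1-≤ S (suc n) q below with S n in Sn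
... | true  = ℕₚ.≤-trans (ℕₚ.≤-reflexive (ℕₚ.+-identityʳ (suc n))) (below n (ℕₚ.n<1+n n) Sn)
... | false = topSum1-≤ S n q (λ i i<n → below i (ℕₚ.m<n⇒m<1+n i<n))

topSum2-≤ : ∀ S n p q → q ≤ p → (∀ i → i < n → S i ≡ true → suc i ≡ p ⊎ i < q) →
  topSum 2 S n ≤ p + q
topSum2-≤ S zero    p q _   _     = z≤n
topSum2-≤ S (suc n) p q q≤p located with S n in Sn
... | false = topSum2-≤ S n p q q≤p (λ i i<n → located i (ℕₚ.m<n⇒m<1+n i<n))
... | true with located n (ℕₚ.n<1+n n) Sn
...   | inj₁ 1+n≡p = ℕₚ.+-mono-≤ (ℕₚ.≤-reflexive 1+n≡p) (topSum1-≤ S n q below)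
  where
  below : ∀ i → i < n → S i ≡ true → i < q
  below i i<n Si with located i (ℕₚ.m<n⇒m<1+n i<n) Si
  ... | inj₁ 1+i≡p = ⊥-elim (ℕₚ.<-irrefl (ℕₚ.suc-injective (trans 1+i≡p (sym 1+n≡p))) i<n)
  ... | inj₂ i<q   = i<q
...   | inj₂ n<q = ℕₚ.+-mono-≤ (ℕₚ.≤-trans n<q q≤p) (topSum1-≤ S n q (λ i i<n _ → ℕₚ.<-trans i<n n<q))

-- Finite sums

sumFinℕ-cong : ∀ s {f g} → (∀ j → f j ≡ g j) → sumFinℕ s f ≡ sumFinℕ s g
sumFinℕ-cong zero    _  = refl
sumFinℕ-cong (suc s) f≡g = cong₂ _+_ (f≡g Fin.zero) (sumFinℕ-cong s (λ j → f≡g (Fin.suc j)))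

sumFinℕ-+ : ∀ s f g → sumFinℕ s (λ j → f j + g j) ≡ sumFinℕ s f + sumFinℕ s g
sumFinℕ-+ zero    f g = refl
sumFinℕ-+ (suc s) f g = trans
  (cong (λ w → f Fin.zero + g Fin.zero + w) (sumFinℕ-+ s (λ j → f (Fin.suc j)) (λ j → g (Fin.suc j))))
  (ℕ+.interchange (f Fin.zero) (g Fin.zero) (sumFinℕ s (λ j → f (Fin.suc j))) (sumFinℕ s (λ j → g (Fin.suc j))))

sumFinℕ-mono : ∀ s {f g} → (∀ j → f j ≤ g j) → sumFinℕ s f ≤ sumFinℕ s g
sumFinℕ-mono zero    _   = z≤n
sumFinℕ-mono (suc s) f≤g = ℕₚ.+-mono-≤ (f≤g Fin.zero) (sumFinℕ-mono s (λ j → f≤g (Fin.suc j)))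

≤-sumFinℕ : ∀ s f j → f j ≤ sumFinℕ s f
≤-sumFinℕ (suc s) f Fin.zero    = ℕₚ.m≤m+n _ _
≤-sumFinℕ (suc s) f (Fin.suc j) = ℕₚ.≤-trans (≤-sumFinℕ s (λ j → f (Fin.suc j)) j) (ℕₚ.m≤n+m _ _)

xsum-cong : ∀ n {f g} → (∀ i → f i ≡ g i) → xsum n f ≡ xsum n g
xsum-cong zero    _   = refl
xsum-cong (suc n) f≡g = cong₂ _xor_ (xsum-cong n f≡g) (f≡g n)

xsum-xor : ∀ n f g → xsum n (λ i → f i xor g i) ≡ xsum n f xor xsum n g
xsum-xor zero    f g = refl
xsum-xor (suc n) f g = trans (cong (_xor (f n xor g n)) (xsum-xor n f g)) (𝔽₂+.interchange (xsum n f) (xsum n g) (f n) (g n))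

xsumFin-cong : ∀ s {f g} → (∀ j → f j ≡ g j) → xsumFin s f ≡ xsumFin s g
xsumFin-cong zero    _   = refl
xsumFin-cong (suc s) f≡g = cong₂ _xor_ (f≡g Fin.zero) (xsumFin-cong s (λ j → f≡g (Fin.suc j)))

xsumFin-xor : ∀ s f g → xsumFin s (λ j → f j xor g j) ≡ xsumFin s f xor xsumFin s g
xsumFin-xor zero    f g = refl
xsumFin-xor (suc s) f g = trans
  (cong ((f Fin.zero xor g Fin.zero) xor_) (xsumFin-xor s (λ j → f (Fin.suc j)) (λ j → g (Fin.suc j))))
  (𝔽₂+.interchange (f Fin.zero) (g Fin.zero) (xsumFin s (λ j → f (Fin.suc j))) (xsumFin s (λ j → g (Fin.suc j))))

xor-≡false : ∀ {a b} → a xor b ≡ false → a ≡ b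
xor-≡false {true}  {true}  _ = refl
xor-≡false {false} {false} _ = refl

xor-cancelʳ : ∀ a b c → (a xor c) xor (b xor c) ≡ a xor b
xor-cancelʳ a b c = trans (𝔽₂+.interchange a c b c) (trans (cong ((a xor b) xor_) (xor-same c)) (xor-identityʳ (a xor b)))

allFinᵇ-cong : ∀ s {f g} → (∀ j → f j ≡ g j) → allFinᵇ s f ≡ allFinᵇ s g
allFinᵇ-cong zero    _   = refl
allFinᵇ-cong (suc s) f≡g = cong₂ _∧_ (f≡g Fin.zero) (allFinᵇ-cong s (λ j → f≡g (Fin.suc j)))

allFinᵇ⇒ : ∀ s {f} → allFinᵇ s f ≡ true → ∀ j → f j ≡ true
allFinᵇ⇒ (suc s) h Fin.zero    = ∧-conicalˡ _ _ h
allFinᵇ⇒ (suc s) h (Fin.suc j) = allFinᵇ⇒ s (∧-conicalʳ _ _ h) j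

allFinᵇ⇐ : ∀ s {f} → (∀ j → f j ≡ true) → allFinᵇ s f ≡ true
allFinᵇ⇐ zero    _   = refl
allFinᵇ⇐ (suc s) all = cong₂ _∧_ (all Fin.zero) (allFinᵇ⇐ s (λ j → all (Fin.suc j)))

allBelow-cong : ∀ n {f g} → (∀ c → f c ≡ g c) → allBelow n f ≡ allBelow n g
allBelow-cong zero    _   = refl
allBelow-cong (suc n) f≡g = cong₂ _∧_ (allBelow-cong n f≡g) (f≡g n)

allBelow⇒ : ∀ n {f} → allBelow n f ≡ true → ∀ c → c < n → f c ≡ true
allBelow⇒ (suc n) h c c<1+n with ℕₚ.m<1+n⇒m<n∨m≡n c<1+n
... | inj₁ c<n  = allBelow⇒ n (∧-conicalˡ _ _ h) c c<n
... | inj₂ refl = ∧-conicalʳ _ _ h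

-- Dual nets

module _ {s : ℕ} (C : Matrices s) (m : ℕ) where

  columnSum : (Fin s → ℕ) → ℕ → Bool
  columnSum k col = xsumFin s (λ j → xsum (2 ℕ.* m) (λ i → bit (k j) i ∧ C j i col))

  columnSum-cong : ∀ {k k'} → (∀ j → k j ≡ k' j) → ∀ col → columnSum k col ≡ columnSum k' col
  columnSum-cong k≡k' col = xsumFin-cong s (λ j → cong (λ x → xsum (2 ℕ.* m) (λ i → bit x i ∧ C j i col)) (k≡k' j))

  columnSum-⊕ : ∀ k k' col →
    columnSum (λ j → k j ⊕ k' j) col ≡ columnSum k col xor columnSum k' col
  columnSum-⊕ k k' col = begin
    columnSum (λ j → k j ⊕ k' j) col
      ≡⟨ xsumFin-cong s (λ j → xsum-cong (2 ℕ.* m) (λ i →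
           trans (cong (_∧ C j i col) (bit-⊕ (k j) (k' j) i)) (∧-distribʳ-xor (C j i col) (bit (k j) i) (bit (k' j) i)))) ⟩
    xsumFin s (λ j → xsum (2 ℕ.* m) (λ i → (bit (k j) i ∧ C j i col) xor (bit (k' j) i ∧ C j i col)))
      ≡⟨ xsumFin-cong s (λ j → xsum-xor (2 ℕ.* m) _ _) ⟩
    xsumFin s (λ j → xsum (2 ℕ.* m) (λ i → bit (k j) i ∧ C j i col) xor xsum (2 ℕ.* m) (λ i → bit (k' j) i ∧ C j i col))
      ≡⟨ xsumFin-xor s _ _ ⟩
    columnSum k col xor columnSum k' col
      ∎
    where open ≡-Reasoning

  inDualStarᵇ-cong : ∀ {k k'} → (∀ j → k j ≡ k' j) → inDualStarᵇ C m k ≡ inDualStarᵇ C m k'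
  inDualStarᵇ-cong k≡k' = cong₂ _∧_
    (allBelow-cong m (λ col → cong not (columnSum-cong k≡k' col)))
    (cong not (allFinᵇ-cong s (λ j → cong (_≡ᵇ 0) (k≡k' j))))

  inDualStarᵇ⇒columnSum : ∀ {k} → inDualStarᵇ C m k ≡ true → ∀ col → col < m → columnSum k col ≡ false
  inDualStarᵇ⇒columnSum h col col<m = not-injective (allBelow⇒ m (∧-conicalˡ _ _ h) col col<m)

  inDualStarᵇ⇒nonzero : ∀ {k} → inDualStarᵇ C m k ≡ true → ¬ (∀ j → k j ≡ 0)
  inDualStarᵇ⇒nonzero {k} h k≡0 with () ← trans (sym (not-injective (∧-conicalʳ _ _ h)))
    (allFinᵇ⇐ s (λ j → subst (λ x → (x ≡ᵇ 0) ≡ true) (sym (k≡0 j)) refl))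

dual-bits-vanish : ∀ {s t C m} → IsOrder2DigitalSeq s t C → t < 2 ℕ.* m → (k : Fin s → ℕ) →
  sumFinℕ s (λ j → topSum 2 (bit (k j)) (2 ℕ.* m)) + t ≤ 2 ℕ.* m →
  (∀ col → col < m → columnSum C m k col ≡ false) →
  ∀ j i → i < 2 ℕ.* m → bit (k j) i ≡ false
dual-bits-vanish {m = m} order2 t<2m k light cols =
  proj₂ order2 m t<2m (λ j → bit (k j)) light (λ j → bit (k j)) (λ _ _ _ h → h) cols

-- Rationals and their sums

toℚ : ℕ → ℚ
toℚ n = + n / 1

toℚ≡mkℚ : ∀ n → toℚ n ≡ ℚ.mkℚ (+ n) 0 (Coprimality.sym (Coprimality.1-coprimeTo n))
toℚ≡mkℚ n = ℚₚ.normalize-coprime (Coprimality.sym (Coprimality.1-coprimeTo n))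

toℚ-+ : ∀ m n → toℚ m ℚ.+ toℚ n ≡ toℚ (m + n)
toℚ-+ m n rewrite toℚ≡mkℚ m | toℚ≡mkℚ n =
  cong (_/ 1) (cong₂ ℤ._+_ (ℤₚ.*-identityʳ (+ m)) (ℤₚ.*-identityʳ (+ n)))

toℚ-* : ∀ m n → toℚ m * toℚ n ≡ toℚ (m ℕ.* n)
toℚ-* m n rewrite toℚ≡mkℚ m | toℚ≡mkℚ n = cong (_/ 1) (sym (ℤₚ.pos-* m n))

0≤toℚ : ∀ n → 0ℚ ≤ℚ toℚ n
0≤toℚ n = ℚₚ.nonNegative⁻¹ (toℚ n) {{ℚₚ.normalize-nonNeg n 1}}

toℚ-mono-≤ : ∀ {m n} → m ≤ n → toℚ m ≤ℚ toℚ n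
toℚ-mono-≤ {m} {n} m≤n = begin
  toℚ m                    ≡⟨ sym (ℚₚ.+-identityʳ (toℚ m)) ⟩
  toℚ m ℚ.+ 0ℚ             ≤⟨ ℚₚ.+-monoʳ-≤ (toℚ m) (0≤toℚ (n ∸ m)) ⟩
  toℚ m ℚ.+ toℚ (n ∸ m)    ≡⟨ toℚ-+ m (n ∸ m) ⟩
  toℚ (m + (n ∸ m))        ≡⟨ cong toℚ (ℕₚ.m+[n∸m]≡n m≤n) ⟩
  toℚ n                    ∎
  where open ℚₚ.≤-Reasoning

0≤1 : 0ℚ ≤ℚ 1ℚ
0≤1 = toℚ-mono-≤ {0} {1} z≤n

*-monoʳ-≤-0≤ : ∀ c {a b} → 0ℚ ≤ℚ c → a ≤ℚ b → c * a ≤ℚ c * b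
*-monoʳ-≤-0≤ c 0≤c = ℚₚ.*-monoˡ-≤-nonNeg c {{ℚ.nonNegative 0≤c}}

*-monoˡ-≤-0≤ : ∀ c {a b} → 0ℚ ≤ℚ c → a ≤ℚ b → a * c ≤ℚ b * c
*-monoˡ-≤-0≤ c 0≤c = ℚₚ.*-monoʳ-≤-nonNeg c {{ℚ.nonNegative 0≤c}}

0≤* : ∀ {a b} → 0ℚ ≤ℚ a → 0ℚ ≤ℚ b → 0ℚ ≤ℚ a * b
0≤* {a} 0≤a 0≤b = subst (_≤ℚ a * _) (ℚₚ.*-zeroʳ a) (*-monoʳ-≤-0≤ a 0≤a 0≤b)

*-mono-≤-0≤ : ∀ {a a' b b'} → 0ℚ ≤ℚ a → 0ℚ ≤ℚ b' → a ≤ℚ a' → b ≤ℚ b' → a * b ≤ℚ a' * b'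
*-mono-≤-0≤ {a} {b' = b'} 0≤a 0≤b' a≤a' b≤b' =
  ℚₚ.≤-trans (*-monoʳ-≤-0≤ a 0≤a b≤b') (*-monoˡ-≤-0≤ b' 0≤b' a≤a')

pow2neg-+ : ∀ a b → pow2neg (a + b) ≡ pow2neg a * pow2neg b
pow2neg-+ zero    b = sym (ℚₚ.*-identityˡ _)
pow2neg-+ (suc a) b = trans (cong (½ *_) (pow2neg-+ a b)) (sym (ℚₚ.*-assoc ½ (pow2neg a) (pow2neg b)))

pow2-+ : ∀ a b → pow2 (a + b) ≡ pow2 a * pow2 b
pow2-+ a b = trans (cong toℚ (ℕₚ.^-distribˡ-+-* 2 a b)) (sym (toℚ-* (2 ^ a) (2 ^ b)))

pow2*pow2neg : ∀ a → pow2 a * pow2neg a ≡ 1ℚ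
pow2*pow2neg zero    = refl
pow2*pow2neg (suc a) = begin
  pow2 (suc a) * (½ * pow2neg a)         ≡⟨ cong (_* (½ * pow2neg a)) (sym (toℚ-* 2 (2 ^ a))) ⟩
  (toℚ 2 * pow2 a) * (½ * pow2neg a)     ≡⟨ interchange (toℚ 2) (pow2 a) ½ (pow2neg a) ⟩
  (toℚ 2 * ½) * (pow2 a * pow2neg a)     ≡⟨ cong (toℚ 2 * ½ *_) (pow2*pow2neg a) ⟩
  1ℚ                                      ∎
  where
  open ≡-Reasoning
  open +-*-Solver
  interchange : ∀ a b c d → (a * b) * (c * d) ≡ (a * c) * (b * d)
  interchange = solve 4 (λ a b c d → (a :* b) :* (c :* d) := (a :* c) :* (b :* d)) refl

0≤pow2neg : ∀ a → 0ℚ ≤ℚ pow2neg a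
0≤pow2neg zero    = 0≤1
0≤pow2neg (suc a) = 0≤* (ℚₚ.nonNegative⁻¹ ½) (0≤pow2neg a)

toℚ*pow2neg-≤ : ∀ x y x' y' → x ℕ.* 2 ^ y' ≤ x' ℕ.* 2 ^ y → toℚ x * pow2neg y ≤ℚ toℚ x' * pow2neg y'
toℚ*pow2neg-≤ x y x' y' x2^y'≤x'2^y = begin
  toℚ x * pow2neg y                          ≡⟨ rescale x y y' ⟩
  toℚ (x ℕ.* 2 ^ y') * pow2neg (y + y')      ≤⟨ *-monoˡ-≤-0≤ _ (0≤pow2neg (y + y')) (toℚ-mono-≤ x2^y'≤x'2^y) ⟩
  toℚ (x' ℕ.* 2 ^ y) * pow2neg (y + y')      ≡⟨ cong (λ w → toℚ (x' ℕ.* 2 ^ y) * pow2neg w) (ℕₚ.+-comm y y') ⟩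
  toℚ (x' ℕ.* 2 ^ y) * pow2neg (y' + y)      ≡⟨ sym (rescale x' y' y) ⟩
  toℚ x' * pow2neg y'                        ∎
  where
  open ℚₚ.≤-Reasoning
  shuffle : ∀ a b c d → a * (b * (c * d)) ≡ (a * c) * (b * d)
  shuffle = solve 4 (λ a b c d → a :* (b :* (c :* d)) := (a :* c) :* (b :* d)) refl
    where open +-*-Solver
  rescale : ∀ x y y' → toℚ x * pow2neg y ≡ toℚ (x ℕ.* 2 ^ y') * pow2neg (y + y')
  rescale x y y' = begin-equality
    toℚ x * pow2neg y                                ≡⟨ cong (toℚ x *_) (sym (ℚₚ.*-identityʳ (pow2neg y))) ⟩
    toℚ x * (pow2neg y * 1ℚ)                         ≡⟨ cong (λ w → toℚ x * (pow2neg y * w)) (sym (pow2*pow2neg y')) ⟩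
    toℚ x * (pow2neg y * (pow2 y' * pow2neg y'))     ≡⟨ shuffle (toℚ x) (pow2neg y) (pow2 y') (pow2neg y') ⟩
    (toℚ x * pow2 y') * (pow2neg y * pow2neg y')     ≡⟨ cong₂ _*_ (toℚ-* x (2 ^ y')) (sym (pow2neg-+ y y')) ⟩
    toℚ (x ℕ.* 2 ^ y') * pow2neg (y + y')            ∎

¾ : ℚ
¾ = + 3 / 4

¾^ : ℕ → ℚ
¾^ zero    = 1ℚ
¾^ (suc n) = ¾ * ¾^ n

¾^-+ : ∀ a b → ¾^ (a + b) ≡ ¾^ a * ¾^ b
¾^-+ zero    b = sym (ℚₚ.*-identityˡ _)
¾^-+ (suc a) b = trans (cong (¾ *_) (¾^-+ a b)) (sym (ℚₚ.*-assoc ¾ (¾^ a) (¾^ b)))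

0≤¾^ : ∀ n → 0ℚ ≤ℚ ¾^ n
0≤¾^ zero    = 0≤1
0≤¾^ (suc n) = 0≤* (ℚₚ.nonNegative⁻¹ ¾) (0≤¾^ n)

¾^≡3^*pow2neg : ∀ n → ¾^ n ≡ toℚ (3 ^ n) * pow2neg (n + n)
¾^≡3^*pow2neg zero    = refl
¾^≡3^*pow2neg (suc n) = begin
  ¾ * ¾^ n
    ≡⟨ cong (¾ *_) (¾^≡3^*pow2neg n) ⟩
  (toℚ 3 * ½ * ½) * (toℚ (3 ^ n) * pow2neg (n + n))
    ≡⟨ shuffle (toℚ 3) ½ (toℚ (3 ^ n)) (pow2neg (n + n)) ⟩
  (toℚ 3 * toℚ (3 ^ n)) * (½ * (½ * pow2neg (n + n)))
    ≡⟨ cong₂ _*_ (toℚ-* 3 (3 ^ n)) (cong (λ w → ½ * pow2neg w) (sym (ℕₚ.+-suc n n))) ⟩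
  toℚ (3 ^ suc n) * pow2neg (suc n + suc n)
    ∎
  where
  open ≡-Reasoning
  shuffle : ∀ x h y w → (x * h * h) * (y * w) ≡ (x * y) * (h * (h * w))
  shuffle = solve 4 (λ x h y w → (x :* h :* h) :* (y :* w) := (x :* y) :* (h :* (h :* w))) refl
    where open +-*-Solver

sumℚ-¾^ : ∀ L → sumℚ L ¾^ ℚ.+ toℚ 4 * ¾^ L ≡ toℚ 4
sumℚ-¾^ zero    = refl
sumℚ-¾^ (suc L) = trans (step (sumℚ L ¾^) (¾^ L)) (sumℚ-¾^ L)
  where
  step : ∀ x y → (x ℚ.+ y) ℚ.+ toℚ 4 * (¾ * y) ≡ x ℚ.+ toℚ 4 * y
  step = solve 2 (λ x y → (x :+ y) :+ con (toℚ 4) :* (con ¾ :* y) := x :+ con (toℚ 4) :* y) refl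
    where open +-*-Solver

sumℚ-¾^-≤ : ∀ L → sumℚ L ¾^ ≤ℚ toℚ 4
sumℚ-¾^-≤ L = begin
  sumℚ L ¾^                        ≡⟨ sym (ℚₚ.+-identityʳ _) ⟩
  sumℚ L ¾^ ℚ.+ 0ℚ                 ≤⟨ ℚₚ.+-monoʳ-≤ (sumℚ L ¾^) (0≤* (0≤toℚ 4) (0≤¾^ L)) ⟩
  sumℚ L ¾^ ℚ.+ toℚ 4 * ¾^ L       ≡⟨ sumℚ-¾^ L ⟩
  toℚ 4                            ∎
  where open ℚₚ.≤-Reasoning

sumℚ-cong : ∀ n {g h : ℕ → ℚ} → (∀ x → g x ≡ h x) → sumℚ n g ≡ sumℚ n h
sumℚ-cong zero    _   = refl
sumℚ-cong (suc n) g≡h = cong₂ ℚ._+_ (sumℚ-cong n g≡h) (g≡h n)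

sumℚ-+ : ∀ n (g h : ℕ → ℚ) → sumℚ n (λ x → g x ℚ.+ h x) ≡ sumℚ n g ℚ.+ sumℚ n h
sumℚ-+ zero    g h = sym (ℚₚ.+-identityʳ 0ℚ)
sumℚ-+ (suc n) g h =
  trans (cong (ℚ._+ (g n ℚ.+ h n)) (sumℚ-+ n g h)) (ℚ+.interchange (sumℚ n g) (sumℚ n h) (g n) (h n))

sumℚ-0 : ∀ n → sumℚ n (λ _ → 0ℚ) ≡ 0ℚ
sumℚ-0 zero    = refl
sumℚ-0 (suc n) = trans (ℚₚ.+-identityʳ _) (sumℚ-0 n)

sumℚ-comm : ∀ a b (F : ℕ → ℕ → ℚ) →
  sumℚ a (λ x → sumℚ b (F x)) ≡ sumℚ b (λ y → sumℚ a (λ x → F x y))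
sumℚ-comm zero    b F = sym (sumℚ-0 b)
sumℚ-comm (suc a) b F = trans (cong (ℚ._+ sumℚ b (F a)) (sumℚ-comm a b F)) (sym (sumℚ-+ b _ (F a)))

sumℚ-*ˡ : ∀ n c (g : ℕ → ℚ) → sumℚ n (λ x → c * g x) ≡ c * sumℚ n g
sumℚ-*ˡ zero    c g = sym (ℚₚ.*-zeroʳ c)
sumℚ-*ˡ (suc n) c g = trans (cong (ℚ._+ c * g n) (sumℚ-*ˡ n c g)) (sym (ℚₚ.*-distribˡ-+ c _ _))

sumℚ-*ʳ : ∀ n c (g : ℕ → ℚ) → sumℚ n (λ x → g x * c) ≡ sumℚ n g * c
sumℚ-*ʳ n c g = trans (sumℚ-cong n (λ x → ℚₚ.*-comm (g x) c)) (trans (sumℚ-*ˡ n c g) (ℚₚ.*-comm c _))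

sumℚ-const : ∀ n c → sumℚ n (λ _ → c) ≡ toℚ n * c
sumℚ-const zero    c = sym (ℚₚ.*-zeroˡ c)
sumℚ-const (suc n) c = begin
  sumℚ n (λ _ → c) ℚ.+ c     ≡⟨ cong₂ ℚ._+_ (sumℚ-const n c) (sym (ℚₚ.*-identityˡ c)) ⟩
  toℚ n * c ℚ.+ 1ℚ * c       ≡⟨ sym (ℚₚ.*-distribʳ-+ c (toℚ n) 1ℚ) ⟩
  (toℚ n ℚ.+ 1ℚ) * c         ≡⟨ cong (_* c) (trans (toℚ-+ n 1) (cong toℚ (ℕₚ.+-comm n 1))) ⟩
  toℚ (suc n) * c            ∎
  where open ≡-Reasoning

sumℚ-mono-≤ : ∀ n {g h : ℕ → ℚ} → (∀ x → x < n → g x ≤ℚ h x) → sumℚ n g ≤ℚ sumℚ n h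
sumℚ-mono-≤ zero    _   = ℚₚ.≤-refl
sumℚ-mono-≤ (suc n) g≤h =
  ℚₚ.+-mono-≤ (sumℚ-mono-≤ n (λ x x<n → g≤h x (ℕₚ.m<n⇒m<1+n x<n))) (g≤h n (ℕₚ.n<1+n n))

0≤sumℚ : ∀ n {g : ℕ → ℚ} → (∀ x → 0ℚ ≤ℚ g x) → 0ℚ ≤ℚ sumℚ n g
0≤sumℚ zero    _   = ℚₚ.≤-refl
0≤sumℚ (suc n) 0≤g = ℚₚ.+-mono-≤ (0≤sumℚ n 0≤g) (0≤g n)

sumℚ-≡0 : ∀ n {g : ℕ → ℚ} → (∀ x → x < n → g x ≡ 0ℚ) → sumℚ n g ≡ 0ℚ
sumℚ-≡0 zero    _   = refl
sumℚ-≡0 (suc n) g≡0 = cong₂ ℚ._+_ (sumℚ-≡0 n (λ x x<n → g≡0 x (ℕₚ.m<n⇒m<1+n x<n))) (g≡0 n (ℕₚ.n<1+n n))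

sumℚ-++ : ∀ a b (g : ℕ → ℚ) → sumℚ (a + b) g ≡ sumℚ a g ℚ.+ sumℚ b (λ i → g (a + i))
sumℚ-++ a zero    g rewrite ℕₚ.+-identityʳ a = sym (ℚₚ.+-identityʳ _)
sumℚ-++ a (suc b) g rewrite ℕₚ.+-suc a b =
  trans (cong (ℚ._+ g (a + b)) (sumℚ-++ a b g)) (ℚₚ.+-assoc (sumℚ a g) (sumℚ b (λ i → g (a + i))) (g (a + b)))

sumℚ-* : ∀ E D (g : ℕ → ℚ) → sumℚ (E ℕ.* D) g ≡ sumℚ E (λ q → sumℚ D (λ r → g (q ℕ.* D + r)))
sumℚ-* zero    D g = refl
sumℚ-* (suc E) D g = begin
  sumℚ (D + E ℕ.* D) g
    ≡⟨ cong (λ n → sumℚ n g) (ℕₚ.+-comm D (E ℕ.* D)) ⟩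
  sumℚ (E ℕ.* D + D) g
    ≡⟨ sumℚ-++ (E ℕ.* D) D g ⟩
  sumℚ (E ℕ.* D) g ℚ.+ sumℚ D (λ r → g (E ℕ.* D + r))
    ≡⟨ cong (ℚ._+ sumℚ D (λ r → g (E ℕ.* D + r))) (sumℚ-* E D g) ⟩
  sumℚ (suc E) (λ q → sumℚ D (λ r → g (q ℕ.* D + r)))
    ∎
  where open ≡-Reasoning

sumℚ-resize : ∀ a a' {g h : ℕ → ℚ} → (∀ x → 0ℚ ≤ℚ h x) →
  (∀ x → x < a → x < a' → g x ≤ℚ h x) → (∀ x → x < a → a' ≤ x → g x ≡ 0ℚ) →
  sumℚ a g ≤ℚ sumℚ a' h
sumℚ-resize a a' {g} {h} 0≤h g≤h g≡0 with ℕₚ.≤-total a a'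
... | inj₁ a≤a' with k , refl ← ℕₚ.m≤n⇒∃[o]m+o≡n a≤a' = begin
  sumℚ a g                                  ≤⟨ sumℚ-mono-≤ a (λ x x<a → g≤h x x<a (ℕₚ.<-≤-trans x<a a≤a')) ⟩
  sumℚ a h                                  ≡⟨ sym (ℚₚ.+-identityʳ _) ⟩
  sumℚ a h ℚ.+ 0ℚ                           ≤⟨ ℚₚ.+-monoʳ-≤ (sumℚ a h) (0≤sumℚ k (λ i → 0≤h (a + i))) ⟩
  sumℚ a h ℚ.+ sumℚ k (λ i → h (a + i))     ≡⟨ sym (sumℚ-++ a k h) ⟩
  sumℚ (a + k) h                            ∎
  where open ℚₚ.≤-Reasoning
... | inj₂ a'≤a with k , refl ← ℕₚ.m≤n⇒∃[o]m+o≡n a'≤a = begin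
  sumℚ (a' + k) g                           ≡⟨ sumℚ-++ a' k g ⟩
  sumℚ a' g ℚ.+ sumℚ k (λ i → g (a' + i))   ≡⟨ cong (sumℚ a' g ℚ.+_) (sumℚ-≡0 k (λ i i<k →
                                                  g≡0 (a' + i) (ℕₚ.+-monoʳ-< a' i<k) (ℕₚ.m≤m+n a' i))) ⟩
  sumℚ a' g ℚ.+ 0ℚ                          ≡⟨ ℚₚ.+-identityʳ _ ⟩
  sumℚ a' g                                 ≤⟨ sumℚ-mono-≤ a' (λ x x<a' → g≤h x (ℕₚ.<-≤-trans x<a' a'≤a) x<a') ⟩
  sumℚ a' h                                 ∎
  where open ℚₚ.≤-Reasoning

boxSum : (s : ℕ) → (Fin s → ℕ) → ((Fin s → ℕ) → ℚ) → ℚ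
boxSum zero    U f = f (λ ())
boxSum (suc s) U f = sumℚ (U Fin.zero) (λ x → boxSum s (λ j → U (Fin.suc j)) (λ v → f (x ∷ᵥ v)))

InBox : ∀ {s} → (Fin s → ℕ) → (Fin s → ℕ) → Set
InBox U v = ∀ j → v j < U j

InBox-∷ : ∀ {s} {U : Fin (suc s) → ℕ} {x v} → x < U Fin.zero → InBox (λ j → U (Fin.suc j)) v → InBox U (x ∷ᵥ v)
InBox-∷ x<U₀ _    Fin.zero    = x<U₀
InBox-∷ _    v∈U' (Fin.suc j) = v∈U' j

Extensional : ∀ {s} {A : Set} → ((Fin s → ℕ) → A) → Set
Extensional f = ∀ u v → (∀ j → u j ≡ v j) → f u ≡ f v

sumBox≡boxSum : ∀ s L f → sumBox s L f ≡ boxSum s (λ _ → L) f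
sumBox≡boxSum zero    L f = refl
sumBox≡boxSum (suc s) L f = sumℚ-cong L (λ x → sumBox≡boxSum s L (λ v → f (x ∷ᵥ v)))

boxSum-cong : ∀ s U {f g : (Fin s → ℕ) → ℚ} → (∀ v → f v ≡ g v) → boxSum s U f ≡ boxSum s U g
boxSum-cong zero    U f≡g = f≡g _
boxSum-cong (suc s) U f≡g = sumℚ-cong (U Fin.zero) (λ x → boxSum-cong s _ (λ v → f≡g (x ∷ᵥ v)))

boxSum-*ˡ : ∀ s U c (f : (Fin s → ℕ) → ℚ) → boxSum s U (λ v → c * f v) ≡ c * boxSum s U f
boxSum-*ˡ zero    U c f = refl
boxSum-*ˡ (suc s) U c f =
  trans (sumℚ-cong (U Fin.zero) (λ x → boxSum-*ˡ s _ c (λ v → f (x ∷ᵥ v)))) (sumℚ-*ˡ (U Fin.zero) c _)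

boxSum-mono-≤ : ∀ s U {f g : (Fin s → ℕ) → ℚ} → (∀ v → f v ≤ℚ g v) → boxSum s U f ≤ℚ boxSum s U g
boxSum-mono-≤ zero    U f≤g = f≤g _
boxSum-mono-≤ (suc s) U f≤g = sumℚ-mono-≤ (U Fin.zero) (λ x _ → boxSum-mono-≤ s _ (λ v → f≤g (x ∷ᵥ v)))

0≤boxSum : ∀ s U {f : (Fin s → ℕ) → ℚ} → (∀ v → 0ℚ ≤ℚ f v) → 0ℚ ≤ℚ boxSum s U f
0≤boxSum zero    U 0≤f = 0≤f _
0≤boxSum (suc s) U 0≤f = 0≤sumℚ (U Fin.zero) (λ x → 0≤boxSum s _ (λ v → 0≤f (x ∷ᵥ v)))

boxSum-≡0 : ∀ s U {f : (Fin s → ℕ) → ℚ} → (∀ v → InBox U v → f v ≡ 0ℚ) → boxSum s U f ≡ 0ℚ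
boxSum-≡0 zero    U f≡0 = f≡0 _ (λ ())
boxSum-≡0 (suc s) U f≡0 =
  sumℚ-≡0 (U Fin.zero) (λ x x<U₀ → boxSum-≡0 s _ (λ v v∈U' → f≡0 (x ∷ᵥ v) (InBox-∷ x<U₀ v∈U')))

sumℚ-boxSum-comm : ∀ s U a (F : ℕ → (Fin s → ℕ) → ℚ) →
  sumℚ a (λ x → boxSum s U (F x)) ≡ boxSum s U (λ v → sumℚ a (λ x → F x v))
sumℚ-boxSum-comm zero    U a F = refl
sumℚ-boxSum-comm (suc s) U a F = trans (sumℚ-comm a (U Fin.zero) _)
  (sumℚ-cong (U Fin.zero) (λ y → sumℚ-boxSum-comm s _ a (λ x v → F x (y ∷ᵥ v))))

boxSum-comm : ∀ s s' U U' (F : (Fin s → ℕ) → (Fin s' → ℕ) → ℚ) →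
  boxSum s U (λ u → boxSum s' U' (F u)) ≡ boxSum s' U' (λ v → boxSum s U (λ u → F u v))
boxSum-comm zero    s' U U' F = refl
boxSum-comm (suc s) s' U U' F = trans
  (sumℚ-cong (U Fin.zero) (λ x → boxSum-comm s s' _ U' (λ u → F (x ∷ᵥ u))))
  (sumℚ-boxSum-comm s' U' (U Fin.zero) _)

boxSum-resize : ∀ s U U' {f : (Fin s → ℕ) → ℚ} → (∀ v → 0ℚ ≤ℚ f v) →
  (∀ v → InBox U v → f v ≡ 0ℚ ⊎ InBox U' v) → boxSum s U f ≤ℚ boxSum s U' f
boxSum-resize zero    U U' _       _       = ℚₚ.≤-refl
boxSum-resize (suc s) U U' {f} 0≤f support = sumℚ-resize (U Fin.zero) (U' Fin.zero)
  (λ x → 0≤boxSum s _ (λ v → 0≤f (x ∷ᵥ v)))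
  (λ x x<U₀ _ → boxSum-resize s _ _ (λ v → 0≤f (x ∷ᵥ v)) (λ v v∈U → tail x v (support (x ∷ᵥ v) (InBox-∷ x<U₀ v∈U))))
  (λ x x<U₀ U'₀≤x → boxSum-≡0 s _ (λ v v∈U → outside x v U'₀≤x (support (x ∷ᵥ v) (InBox-∷ x<U₀ v∈U))))
  where
  tail : ∀ x v → f (x ∷ᵥ v) ≡ 0ℚ ⊎ InBox U' (x ∷ᵥ v) → f (x ∷ᵥ v) ≡ 0ℚ ⊎ InBox (λ j → U' (Fin.suc j)) v
  tail x v (inj₁ f≡0)  = inj₁ f≡0
  tail x v (inj₂ ∈U') = inj₂ (λ j → ∈U' (Fin.suc j))
  outside : ∀ x v → U' Fin.zero ≤ x → f (x ∷ᵥ v) ≡ 0ℚ ⊎ InBox U' (x ∷ᵥ v) → f (x ∷ᵥ v) ≡ 0ℚ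
  outside x v _     (inj₁ f≡0)  = f≡0
  outside x v U'₀≤x (inj₂ ∈U') = ⊥-elim (ℕₚ.<⇒≱ (∈U' Fin.zero) U'₀≤x)

boxSum-* : ∀ s E D (f : (Fin s → ℕ) → ℚ) → Extensional f →
  boxSum s (λ j → E j ℕ.* D j) f ≡ boxSum s E (λ q → boxSum s D (λ r → f (λ j → q j ℕ.* D j + r j)))
boxSum-* zero    E D f ext = ext _ _ (λ ())
boxSum-* (suc s) E D f ext = trans (sumℚ-* (E Fin.zero) (D Fin.zero) _)
  (sumℚ-cong (E Fin.zero) λ q₀ → trans
    (sumℚ-cong (D Fin.zero) (λ r₀ → boxSum-* s _ _ _ (λ u v u≡v → ext _ _ (λ { Fin.zero → refl ; (Fin.suc j) → u≡v j }))))
    (trans (sumℚ-boxSum-comm s _ (D Fin.zero) _)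
      (boxSum-cong s _ λ q → sumℚ-cong (D Fin.zero) λ r₀ → boxSum-cong s _ λ r →
        ext _ _ λ { Fin.zero → refl ; (Fin.suc j) → refl })))

boxSum-2^-1 : ∀ s (e : Fin s → ℕ) → boxSum s (λ j → 2 ^ e j) (λ _ → 1ℚ) ≡ pow2 (sumFinℕ s e)
boxSum-2^-1 zero    e = refl
boxSum-2^-1 (suc s) e = begin
  sumℚ (2 ^ e₀) (λ _ → boxSum s (λ j → 2 ^ e (Fin.suc j)) (λ _ → 1ℚ)) ≡⟨ sumℚ-cong (2 ^ e₀) (λ _ → boxSum-2^-1 s e') ⟩
  sumℚ (2 ^ e₀) (λ _ → pow2 (sumFinℕ s e'))                           ≡⟨ sumℚ-const (2 ^ e₀) (pow2 (sumFinℕ s e')) ⟩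
  toℚ (2 ^ e₀) * pow2 (sumFinℕ s e')                                  ≡⟨ sym (pow2-+ e₀ (sumFinℕ s e')) ⟩
  pow2 (e₀ + sumFinℕ s e')                                            ∎
  where
  open ≡-Reasoning
  e₀ = e Fin.zero
  e' = λ j → e (Fin.suc j)

sumℚ-≤1 : ∀ n {g : ℕ → ℚ} → (∀ x → x < n → g x ≤ℚ 1ℚ) →
  (∀ x y → x < y → y < n → g x ≡ 0ℚ ⊎ g y ≡ 0ℚ) → sumℚ n g ≤ℚ 1ℚ
sumℚ-≤1 zero    _   _        = 0≤1
sumℚ-≤1 (suc n) {g} g≤1 disjoint with g n ℚₚ.≟ 0ℚ
... | yes gn≡0 = begin
  sumℚ n g ℚ.+ g n      ≡⟨ trans (cong (sumℚ n g ℚ.+_) gn≡0) (ℚₚ.+-identityʳ _) ⟩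
  sumℚ n g              ≤⟨ sumℚ-≤1 n (λ x x<n → g≤1 x (ℕₚ.m<n⇒m<1+n x<n))
                                     (λ x y x<y y<n → disjoint x y x<y (ℕₚ.m<n⇒m<1+n y<n)) ⟩
  1ℚ                    ∎
  where open ℚₚ.≤-Reasoning
... | no  gn≢0 = begin
  sumℚ n g ℚ.+ g n      ≡⟨ trans (cong (ℚ._+ g n) (sumℚ-≡0 n earlier≡0)) (ℚₚ.+-identityˡ _) ⟩
  g n                   ≤⟨ g≤1 n (ℕₚ.n<1+n n) ⟩
  1ℚ                    ∎
  where
  open ℚₚ.≤-Reasoning
  earlier≡0 : ∀ x → x < n → g x ≡ 0ℚ
  earlier≡0 x x<n with disjoint x n x<n (ℕₚ.n<1+n n)
  ... | inj₁ gx≡0 = gx≡0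
  ... | inj₂ gn≡0 = ⊥-elim (gn≢0 gn≡0)

-- Equality on ℚ is decidable, so whether a slice sum vanishes is decided without
-- searching the slice for a point of the support.
boxSum-≤1 : ∀ s U {f : (Fin s → ℕ) → ℚ} → (∀ v → f v ≤ℚ 1ℚ) →
  (∀ u v → InBox U u → InBox U v → ¬ f u ≡ 0ℚ → ¬ f v ≡ 0ℚ → ∀ j → u j ≡ v j) →
  boxSum s U f ≤ℚ 1ℚ
boxSum-≤1 zero    U f≤1 _      = f≤1 _
boxSum-≤1 (suc s) U {f} f≤1 unique = sumℚ-≤1 (U Fin.zero) slice≤1 disjoint
  where
  U' = λ j → U (Fin.suc j)
  slice : ℕ → ℚ
  slice x = boxSum s U' (λ v → f (x ∷ᵥ v))
  slice≤1 : ∀ x → x < U Fin.zero → slice x ≤ℚ 1ℚ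
  slice≤1 x x<U₀ = boxSum-≤1 s U' (λ v → f≤1 (x ∷ᵥ v))
    (λ u v u∈U' v∈U' fu≢0 fv≢0 j → unique _ _ (InBox-∷ x<U₀ u∈U') (InBox-∷ x<U₀ v∈U') fu≢0 fv≢0 (Fin.suc j))
  vanishes : ∀ x y → x < y → y < U Fin.zero → ∀ v → InBox U' v → ¬ f (y ∷ᵥ v) ≡ 0ℚ →
    ∀ u → InBox U' u → f (x ∷ᵥ u) ≡ 0ℚ
  vanishes x y x<y y<U₀ v v∈U' fyv≢0 u u∈U' with f (x ∷ᵥ u) ℚₚ.≟ 0ℚ
  ... | yes fxu≡0 = fxu≡0
  ... | no  fxu≢0 = ⊥-elim (ℕₚ.<-irrefl
    (unique _ _ (InBox-∷ (ℕₚ.<-trans x<y y<U₀) u∈U') (InBox-∷ y<U₀ v∈U') fxu≢0 fyv≢0 Fin.zero) x<y)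
  disjoint : ∀ x y → x < y → y < U Fin.zero → slice x ≡ 0ℚ ⊎ slice y ≡ 0ℚ
  disjoint x y x<y y<U₀ with slice x ℚₚ.≟ 0ℚ
  ... | yes slice≡0 = inj₁ slice≡0
  ... | no  slice≢0 = inj₂ (boxSum-≡0 s U' fy≡0)
    where
    fy≡0 : ∀ v → InBox U' v → f (y ∷ᵥ v) ≡ 0ℚ
    fy≡0 v v∈U' with f (y ∷ᵥ v) ℚₚ.≟ 0ℚ
    ... | yes fyv≡0 = fyv≡0
    ... | no  fyv≢0 = ⊥-elim (slice≢0 (boxSum-≡0 s U' (vanishes x y x<y y<U₀ v v∈U' fyv≢0)))

boxSum-¾^ : ∀ s L → boxSum s (λ _ → L) (λ z → ¾^ (norm1 z)) ≤ℚ toℚ (4 ^ s)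
boxSum-¾^ zero    L = ℚₚ.≤-refl
boxSum-¾^ (suc s) L = begin
  sumℚ L (λ x → boxSum s (λ _ → L) (λ v → ¾^ (x + norm1 v)))
    ≡⟨ sumℚ-cong L (λ x → trans (boxSum-cong s _ (λ v → ¾^-+ x (norm1 v))) (boxSum-*ˡ s _ (¾^ x) _)) ⟩
  sumℚ L (λ x → ¾^ x * boxSum s (λ _ → L) (λ v → ¾^ (norm1 v)))
    ≡⟨ sumℚ-*ʳ L _ ¾^ ⟩
  sumℚ L ¾^ * boxSum s (λ _ → L) (λ v → ¾^ (norm1 v))
    ≤⟨ *-mono-≤-0≤ (0≤sumℚ L 0≤¾^) (0≤toℚ (4 ^ s)) (sumℚ-¾^-≤ L) (boxSum-¾^ s L) ⟩
  toℚ 4 * toℚ (4 ^ s)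
    ≡⟨ toℚ-* 4 (4 ^ s) ⟩
  toℚ (4 ^ suc s)
    ∎
  where open ℚₚ.≤-Reasoning

indicator : Bool → ℚ
indicator c = if c then 1ℚ else 0ℚ

0≤indicator : ∀ c → 0ℚ ≤ℚ indicator c
0≤indicator true  = 0≤1
0≤indicator false = ℚₚ.≤-refl

indicator-≤1 : ∀ c → indicator c ≤ℚ 1ℚ
indicator-≤1 true  = ℚₚ.≤-refl
indicator-≤1 false = 0≤1

indicator≢0 : ∀ {c} → ¬ indicator c ≡ 0ℚ → c ≡ true
indicator≢0 {true}  _    = refl
indicator≢0 {false} ≢0 = ⊥-elim (≢0 refl)

if-then-0 : ∀ c (x : ℚ) → (if c then x else 0ℚ) ≡ x * indicator c
if-then-0 true  x = sym (ℚₚ.*-identityʳ x)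
if-then-0 false x = sym (ℚₚ.*-zeroʳ x)

-- Arithmetic of the exponents

-- 2^{a+n} ≤ 2^t · 3^n whenever a ≤ t + n/2, since 2^{3/2} < 3.
2^[a+n]≤2^t*3^n : ∀ n a t → a + a ≤ n + (t + t) → 2 ^ (a + n) ≤ 2 ^ t ℕ.* 3 ^ n
2^[a+n]≤2^t*3^n zero a t a+a≤ = begin
  2 ^ (a + 0)     ≡⟨ cong (2 ^_) (ℕₚ.+-identityʳ a) ⟩
  2 ^ a           ≤⟨ ℕₚ.^-monoʳ-≤ 2 (half-≤ a t a+a≤) ⟩
  2 ^ t           ≡⟨ sym (ℕₚ.*-identityʳ (2 ^ t)) ⟩
  2 ^ t ℕ.* 1     ∎
  where
  open ℕₚ.≤-Reasoning
  half-≤ : ∀ a t → a + a ≤ t + t → a ≤ t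
  half-≤ a t a+a≤t+t = ℕₚ.≮⇒≥ λ t<a → ℕₚ.<⇒≱ (ℕₚ.+-mono-< t<a t<a) a+a≤t+t
2^[a+n]≤2^t*3^n (suc zero) a t a+a≤ = begin
  2 ^ (a + 1)     ≡⟨ ℕₚ.^-distribˡ-+-* 2 a 1 ⟩
  2 ^ a ℕ.* 2     ≤⟨ ℕₚ.*-mono-≤ (ℕₚ.^-monoʳ-≤ 2 (half-≤ a t a+a≤)) (ℕₚ.n≤1+n 2) ⟩
  2 ^ t ℕ.* 3     ∎
  where
  open ℕₚ.≤-Reasoning
  half-≤ : ∀ a t → a + a ≤ 1 + (t + t) → a ≤ t
  half-≤ a t a+a≤ = ℕₚ.≮⇒≥ λ t<a →
    ℕₚ.<⇒≱ (ℕₚ.≤-trans (ℕₚ.≤-reflexive (cong suc (sym (ℕₚ.+-suc t t)))) (ℕₚ.+-mono-≤ t<a t<a)) a+a≤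
2^[a+n]≤2^t*3^n (suc (suc n)) zero t _ = begin
  2 ^ (2 + n)               ≤⟨ ℕₚ.^-monoˡ-≤ (2 + n) (ℕₚ.n≤1+n 2) ⟩
  3 ^ (2 + n)               ≤⟨ ℕₚ.m≤n*m (3 ^ (2 + n)) (2 ^ t) {{ℕ.>-nonZero (ℕₚ.m^n>0 2 t)}} ⟩
  2 ^ t ℕ.* 3 ^ (2 + n)     ∎
  where open ℕₚ.≤-Reasoning
2^[a+n]≤2^t*3^n (suc (suc n)) (suc a) t a+a≤ = begin
  2 ^ (suc a + (2 + n))          ≡⟨ cong (2 ^_) (shift a n) ⟩
  2 ^ (3 + (a + n))              ≡⟨ ℕₚ.^-distribˡ-+-* 2 3 (a + n) ⟩
  8 ℕ.* 2 ^ (a + n)              ≤⟨ ℕₚ.*-mono-≤ (ℕₚ.n≤1+n 8) (2^[a+n]≤2^t*3^n n a t a+a≤') ⟩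
  9 ℕ.* (2 ^ t ℕ.* 3 ^ n)        ≡⟨ nine (2 ^ t) (3 ^ n) ⟩
  2 ^ t ℕ.* 3 ^ (2 + n)          ∎
  where
  open ℕₚ.≤-Reasoning
  shift : ∀ a n → suc a + (2 + n) ≡ 3 + (a + n)
  shift = solve-∀
  nine : ∀ x y → 9 ℕ.* (x ℕ.* y) ≡ x ℕ.* (3 ℕ.* (3 ℕ.* y))
  nine = solve-∀
  a+a≤' : a + a ≤ n + (t + t)
  a+a≤' = ℕₚ.≤-pred (ℕₚ.≤-pred (ℕₚ.≤-trans (ℕₚ.≤-reflexive (cong suc (sym (ℕₚ.+-suc a a)))) a+a≤))

2^[m+e]-bound : ∀ m e B n t a → m + e ≤ B + a → a + a ≤ n + (t + t) →
  2 ^ (m + e) ℕ.* 2 ^ (n + n) ≤ (2 ^ t ℕ.* 3 ^ n) ℕ.* 2 ^ (B + n)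
2^[m+e]-bound m e B n t a m+e≤B+a a+a≤ = begin
  2 ^ (m + e) ℕ.* 2 ^ (n + n)            ≤⟨ ℕₚ.*-monoˡ-≤ (2 ^ (n + n)) (ℕₚ.^-monoʳ-≤ 2 m+e≤B+a) ⟩
  2 ^ (B + a) ℕ.* 2 ^ (n + n)            ≡⟨ cong₂ ℕ._*_ (2^-+ B a) (2^-+ n n) ⟩
  (2 ^ B ℕ.* 2 ^ a) ℕ.* (2 ^ n ℕ.* 2 ^ n) ≡⟨ regroup (2 ^ B) (2 ^ a) (2 ^ n) ⟩
  2 ^ B ℕ.* ((2 ^ a ℕ.* 2 ^ n) ℕ.* 2 ^ n) ≡⟨ cong (λ w → 2 ^ B ℕ.* (w ℕ.* 2 ^ n)) (sym (2^-+ a n)) ⟩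
  2 ^ B ℕ.* (2 ^ (a + n) ℕ.* 2 ^ n)      ≤⟨ ℕₚ.*-monoʳ-≤ (2 ^ B) (ℕₚ.*-monoˡ-≤ (2 ^ n) (2^[a+n]≤2^t*3^n n a t a+a≤)) ⟩
  2 ^ B ℕ.* ((2 ^ t ℕ.* 3 ^ n) ℕ.* 2 ^ n) ≡⟨ swap (2 ^ B) (2 ^ t ℕ.* 3 ^ n) (2 ^ n) ⟩
  (2 ^ t ℕ.* 3 ^ n) ℕ.* (2 ^ B ℕ.* 2 ^ n) ≡⟨ cong ((2 ^ t ℕ.* 3 ^ n) ℕ.*_) (sym (2^-+ B n)) ⟩
  (2 ^ t ℕ.* 3 ^ n) ℕ.* 2 ^ (B + n)      ∎
  where
  open ℕₚ.≤-Reasoning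
  2^-+ = ℕₚ.^-distribˡ-+-* 2
  regroup : ∀ x y w → (x ℕ.* y) ℕ.* (w ℕ.* w) ≡ x ℕ.* ((y ℕ.* w) ℕ.* w)
  regroup = solve-∀
  swap : ∀ x y w → x ℕ.* (y ℕ.* w) ≡ y ℕ.* (x ℕ.* w)
  swap = solve-∀

greedy : (s : ℕ) → ℕ → (Fin s → ℕ) → Fin s → ℕ
greedy (suc s) M b Fin.zero    = b Fin.zero ⊓ M
greedy (suc s) M b (Fin.suc j) = greedy s (M ∸ b Fin.zero ⊓ M) (λ j → b (Fin.suc j)) j

greedy-≤ : ∀ s M b j → greedy s M b j ≤ b j
greedy-≤ (suc s) M b Fin.zero    = ℕₚ.m⊓n≤m (b Fin.zero) M
greedy-≤ (suc s) M b (Fin.suc j) = greedy-≤ s _ (λ j → b (Fin.suc j)) j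

⊓-+-⊓-∸ : ∀ x y M → x ⊓ M + y ⊓ (M ∸ x ⊓ M) ≡ (x + y) ⊓ M
⊓-+-⊓-∸ x y M with ℕₚ.≤-total x M
... | inj₁ x≤M rewrite ℕₚ.m≤n⇒m⊓n≡m x≤M =
  trans (ℕₚ.+-distribˡ-⊓ x y (M ∸ x)) (cong ((x + y) ⊓_) (ℕₚ.m+[n∸m]≡n x≤M))
... | inj₂ M≤x rewrite ℕₚ.m≥n⇒m⊓n≡n M≤x | ℕₚ.n∸n≡0 M | ℕₚ.⊓-zeroʳ y =
  trans (ℕₚ.+-identityʳ M) (sym (ℕₚ.m≥n⇒m⊓n≡n (ℕₚ.≤-trans M≤x (ℕₚ.m≤m+n x y))))

sum-greedy : ∀ s M b → sumFinℕ s (greedy s M b) ≡ sumFinℕ s b ⊓ M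
sum-greedy zero    M b = refl
sum-greedy (suc s) M b = trans
  (cong (λ w → b Fin.zero ⊓ M + w) (sum-greedy s (M ∸ b Fin.zero ⊓ M) (λ j → b (Fin.suc j))))
  (⊓-+-⊓-∸ (b Fin.zero) (sumFinℕ s (λ j → b (Fin.suc j))) M)

-- e counts the free high digits of ℓ once |b| ⊓ (m ∸ t) low digits are pinned down.
2^[m+e]-bound-greedy : ∀ m t B n e → 2 ℕ.* m ≤ n + (B + B) + t → e + B ⊓ (m ∸ t) ≡ B →
  2 ^ (m + e) ℕ.* 2 ^ (n + n) ≤ (2 ^ t ℕ.* 3 ^ n) ℕ.* 2 ^ (B + n)
2^[m+e]-bound-greedy m t B n e heavy e+D≡B with ℕₚ.≤-total B (m ∸ t)
... | inj₂ m∸t≤B rewrite ℕₚ.m≥n⇒m⊓n≡n m∸t≤B = 2^[m+e]-bound m e B n t t m+e≤B+t (ℕₚ.m≤n+m (t + t) n)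
  where
  open ℕₚ.≤-Reasoning
  m+e≤B+t : m + e ≤ B + t
  m+e≤B+t = begin
    m + e                 ≤⟨ ℕₚ.+-monoˡ-≤ e (ℕₚ.m≤n+m∸n m t) ⟩
    t + (m ∸ t) + e       ≡⟨ regroup t (m ∸ t) e ⟩
    t + (e + (m ∸ t))     ≡⟨ cong (λ w → t + w) e+D≡B ⟩
    t + B                 ≡⟨ ℕₚ.+-comm t B ⟩
    B + t                 ∎
    where
    regroup : ∀ x y z → x + y + z ≡ x + (z + y)
    regroup = solve-∀
... | inj₁ B≤m∸t rewrite ℕₚ.m≤n⇒m⊓n≡m B≤m∸t | ℕₚ.+-cancelʳ-≡ B e 0 e+D≡B with ℕₚ.≤-total m B
...   | inj₁ m≤B = 2^[m+e]-bound m 0 B n t 0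
  (ℕₚ.≤-trans (ℕₚ.≤-reflexive (ℕₚ.+-identityʳ m)) (ℕₚ.≤-trans m≤B (ℕₚ.m≤m+n B 0))) z≤n
...   | inj₂ B≤m with a , refl ← ℕₚ.m≤n⇒∃[o]m+o≡n B≤m =
  2^[m+e]-bound (B + a) 0 B n t a (ℕₚ.≤-reflexive (ℕₚ.+-identityʳ (B + a)))
    (ℕₚ.≤-trans (ℕₚ.+-cancelˡ-≤ (B + B) _ _ (begin
      B + B + (a + a)          ≡⟨ double B a ⟩
      2 ℕ.* (B + a)            ≤⟨ heavy ⟩
      n + (B + B) + t          ≡⟨ shuffle n (B + B) t ⟩
      B + B + (n + t)          ∎)) (ℕₚ.+-monoʳ-≤ n (ℕₚ.m≤m+n t t)))
  where
  open ℕₚ.≤-Reasoning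
  double : ∀ x y → x + x + (y + y) ≡ 2 ℕ.* (x + y)
  double = solve-∀
  shuffle : ∀ x y z → x + y + z ≡ y + (x + z)
  shuffle = solve-∀

-- With D ≤ m ∸ t digits pinned down and D ≠ 0, the order 2 property applies.
order2-applies : ∀ m t D → 0 < D → D ≤ m ∸ t → t < 2 ℕ.* m × D + D + t ≤ 2 ℕ.* m
order2-applies m t D 0<D D≤m∸t with ℕₚ.≤-total t m
... | inj₂ m≤t with () ← ℕₚ.<⇒≱ (ℕₚ.<-≤-trans 0<D D≤m∸t) (ℕₚ.≤-reflexive (ℕₚ.m≤n⇒m∸n≡0 m≤t))
... | inj₁ t≤m with k , refl ← ℕₚ.m≤n⇒∃[o]m+o≡n t≤m rewrite ℕₚ.m+n∸m≡n t k =
  ℕₚ.<-≤-trans (ℕₚ.m<m+n t 0<D) (ℕₚ.≤-trans (ℕₚ.+-monoʳ-≤ t D≤m∸t) (ℕₚ.m≤m+n (t + k) _)) ,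
  ℕₚ.≤-trans (ℕₚ.+-monoˡ-≤ t (ℕₚ.+-mono-≤ D≤m∸t D≤m∸t)) (ℕₚ.≤-trans (ℕₚ.m≤m+n (k + k + t) t) (ℕₚ.≤-reflexive (double t k)))
  where
  double : ∀ t k → k + k + t + t ≡ 2 ℕ.* (t + k)
  double = solve-∀

weighted-≤-2^t*¾^ : ∀ m B n e t {N : ℚ} → 0ℚ ≤ℚ N → N ≤ℚ pow2 e →
  2 ^ (m + e) ℕ.* 2 ^ (n + n) ≤ (2 ^ t ℕ.* 3 ^ n) ℕ.* 2 ^ (B + n) →
  pow2 m * pow2neg B * (pow2neg n * N) ≤ℚ pow2 t * ¾^ n
weighted-≤-2^t*¾^ m B n e t {N} 0≤N N≤2^e exponents = begin
  pow2 m * pow2neg B * (pow2neg n * N)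
    ≤⟨ *-monoʳ-≤-0≤ _ (0≤* (0≤toℚ (2 ^ m)) (0≤pow2neg B)) (*-monoʳ-≤-0≤ _ (0≤pow2neg n) N≤2^e) ⟩
  pow2 m * pow2neg B * (pow2neg n * pow2 e)
    ≡⟨ shuffle (pow2 m) (pow2neg B) (pow2neg n) (pow2 e) ⟩
  (pow2 m * pow2 e) * (pow2neg B * pow2neg n)
    ≡⟨ cong₂ _*_ (sym (pow2-+ m e)) (sym (pow2neg-+ B n)) ⟩
  toℚ (2 ^ (m + e)) * pow2neg (B + n)
    ≤⟨ toℚ*pow2neg-≤ (2 ^ (m + e)) (B + n) (2 ^ t ℕ.* 3 ^ n) (n + n) exponents ⟩
  toℚ (2 ^ t ℕ.* 3 ^ n) * pow2neg (n + n)
    ≡⟨ cong (_* pow2neg (n + n)) (sym (toℚ-* (2 ^ t) (3 ^ n))) ⟩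
  pow2 t * toℚ (3 ^ n) * pow2neg (n + n)
    ≡⟨ ℚₚ.*-assoc (pow2 t) _ _ ⟩
  pow2 t * (toℚ (3 ^ n) * pow2neg (n + n))
    ≡⟨ cong (pow2 t *_) (sym (¾^≡3^*pow2neg n)) ⟩
  pow2 t * ¾^ n
    ∎
  where
  open ℚₚ.≤-Reasoning
  shuffle : ∀ a b c d → (a * b) * (c * d) ≡ (a * d) * (b * c)
  shuffle = solve 4 (λ a b c d → (a :* b) :* (c :* d) := (a :* d) :* (b :* c)) refl
    where open +-*-Solver

-- Counting the ℓ ∈ B(b) whose dual index lies in 𝒟*_{m,s}

module Counting {s t : ℕ} {C : Matrices s} (order2 : IsOrder2DigitalSeq s t C) (m : ℕ) (b : Fin s → ℕ) where

  dualIndex : (Fin s → ℕ) → (Fin s → ℕ) → Fin s → ℕ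
  dualIndex z ℓ j = ℓ j ⊕ floorPow2pred (z j + μ₁ (ℓ j))

  admissible : (Fin s → ℕ) → (Fin s → ℕ) → Bool
  admissible z ℓ = inBᵇ b ℓ ∧ inDualStarᵇ C m (dualIndex z ℓ)

  admissible-cong : ∀ z → Extensional (admissible z)
  admissible-cong z ℓ ℓ' ℓ≡ℓ' = cong₂ _∧_
    (allFinᵇ-cong s (λ j → cong (λ x → μ₁ x ≡ᵇ b j) (ℓ≡ℓ' j)))
    (inDualStarᵇ-cong C m (λ j → cong (λ x → x ⊕ floorPow2pred (z j + μ₁ x)) (ℓ≡ℓ' j)))

  module _ (z ℓ : Fin s → ℕ) (adm : admissible z ℓ ≡ true) where

    admissible⇒μ₁ : ∀ j → μ₁ (ℓ j) ≡ b j
    admissible⇒μ₁ j = ℕₚ.≡ᵇ⇒≡ _ _ (subst T (sym (allFinᵇ⇒ s (∧-conicalˡ _ _ adm) j)) _)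

    admissible⇒dual : inDualStarᵇ C m (dualIndex z ℓ) ≡ true
    admissible⇒dual = ∧-conicalʳ (inBᵇ b ℓ) _ adm

    admissible⇒< : ∀ j → ℓ j < 2 ^ b j
    admissible⇒< j = subst (λ e → ℓ j < 2 ^ e) (admissible⇒μ₁ j) (<2^μ₁ (ℓ j))

    bit-dualIndex : ∀ j i → bit (dualIndex z ℓ j) i ≡ true → suc i ≡ z j + b j ⊎ i < b j
    bit-dualIndex j i = subst (λ e → bit (dualIndex z ℓ j) i ≡ true → suc i ≡ z j + e ⊎ i < e) (admissible⇒μ₁ j)
      (bit-⊕-floorPow2pred (μ₁ (ℓ j)) (z j + μ₁ (ℓ j)) (ℓ j) i (<2^μ₁ (ℓ j)))

    dualIndex-weight : ∀ n → sumFinℕ s (λ j → topSum 2 (bit (dualIndex z ℓ j)) n) ≤ norm1 z + (norm1 b + norm1 b)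
    dualIndex-weight n = begin
      sumFinℕ s (λ j → topSum 2 (bit (dualIndex z ℓ j)) n)
        ≤⟨ sumFinℕ-mono s (λ j → topSum2-≤ _ n (z j + b j) (b j) (ℕₚ.m≤n+m (b j) (z j)) (λ i _ → bit-dualIndex j i)) ⟩
      sumFinℕ s (λ j → z j + b j + b j)
        ≡⟨ trans (sumFinℕ-+ s (λ j → z j + b j) b) (cong (_+ norm1 b) (sumFinℕ-+ s z b)) ⟩
      norm1 z + norm1 b + norm1 b
        ≡⟨ ℕₚ.+-assoc (norm1 z) (norm1 b) (norm1 b) ⟩
      norm1 z + (norm1 b + norm1 b)
        ∎
      where open ℕₚ.≤-Reasoning

    -- A dual index of too small weight would have to vanish.
    admissible⇒heavy : 2 ℕ.* m ≤ norm1 z + (norm1 b + norm1 b) + t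
    admissible⇒heavy = ℕₚ.≮⇒≥ λ light →
      inDualStarᵇ⇒nonzero C m admissible⇒dual (λ j → bit-injective (λ i → trans (vanish light j i) (sym (bit-zero i))))
      where
      k = dualIndex z ℓ
      z+b<2m : norm1 z + (norm1 b + norm1 b) + t < 2 ℕ.* m → ∀ j → z j + b j < 2 ℕ.* m
      z+b<2m light j = ℕₚ.≤-<-trans
        (ℕₚ.≤-trans (ℕₚ.+-mono-≤ (≤-sumFinℕ s z j) (ℕₚ.≤-trans (≤-sumFinℕ s b j) (ℕₚ.m≤m+n (norm1 b) (norm1 b))))
                    (ℕₚ.m≤m+n _ t)) light
      vanish : norm1 z + (norm1 b + norm1 b) + t < 2 ℕ.* m → ∀ j i → bit (k j) i ≡ false
      vanish light j i with i <? 2 ℕ.* m | bit (k j) i in bit-k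
      ... | yes i<2m | _     = trans (sym bit-k) (dual-bits-vanish order2 (ℕₚ.≤-<-trans (ℕₚ.m≤n+m t _) light) k
                                 (ℕₚ.≤-trans (ℕₚ.+-monoˡ-≤ t (dualIndex-weight (2 ℕ.* m))) (ℕₚ.<⇒≤ light))
                                 (inDualStarᵇ⇒columnSum C m admissible⇒dual) j i i<2m)
      ... | no  i≮2m | false = refl
      ... | no  i≮2m | true  = ⊥-elim (i≮2m (ℕₚ.<-trans (digit<z+b (bit-dualIndex j i bit-k)) (z+b<2m light j)))
        where
        digit<z+b : suc i ≡ z j + b j ⊎ i < b j → i < z j + b j
        digit<z+b (inj₁ 1+i≡) = ℕₚ.≤-reflexive 1+i≡
        digit<z+b (inj₂ i<b)  = ℕₚ.<-≤-trans i<b (ℕₚ.m≤n+m (b j) (z j))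

  bit-dualIndex-⊕ : ∀ z ℓ ℓ' → admissible z ℓ ≡ true → admissible z ℓ' ≡ true → ∀ j i →
    bit (dualIndex z ℓ j ⊕ dualIndex z ℓ' j) i ≡ bit (ℓ j) i xor bit (ℓ' j) i
  bit-dualIndex-⊕ z ℓ ℓ' adm adm' j i = begin
    bit (dualIndex z ℓ j ⊕ dualIndex z ℓ' j) i
      ≡⟨ bit-⊕ _ _ i ⟩
    bit (ℓ j ⊕ floorPow2pred (z j + μ₁ (ℓ j))) i xor bit (ℓ' j ⊕ floorPow2pred (z j + μ₁ (ℓ' j))) i
      ≡⟨ cong₂ (λ e e' → bit (ℓ j ⊕ floorPow2pred (z j + e)) i xor bit (ℓ' j ⊕ floorPow2pred (z j + e')) i)
               (admissible⇒μ₁ z ℓ adm j) (admissible⇒μ₁ z ℓ' adm' j) ⟩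
    bit (ℓ j ⊕ F) i xor bit (ℓ' j ⊕ F) i
      ≡⟨ cong₂ _xor_ (bit-⊕ (ℓ j) F i) (bit-⊕ (ℓ' j) F i) ⟩
    (bit (ℓ j) i xor bit F i) xor (bit (ℓ' j) i xor bit F i)
      ≡⟨ xor-cancelʳ (bit (ℓ j) i) (bit (ℓ' j) i) (bit F i) ⟩
    bit (ℓ j) i xor bit (ℓ' j) i
      ∎
    where
    open ≡-Reasoning
    F = floorPow2pred (z j + b j)

  -- Two admissible ℓ agreeing on all digits from position d_j on agree everywhere: the
  -- digitwise difference of their dual indices lies in the dual net and only involves
  -- rows below d_j.
  admissible-unique : ∀ z {ℓ ℓ'} (d : Fin s → ℕ) → sumFinℕ s d ≤ m ∸ t →
    admissible z ℓ ≡ true → admissible z ℓ' ≡ true →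
    (∀ j i → d j ≤ i → bit (ℓ j) i ≡ bit (ℓ' j) i) → ∀ j → ℓ j ≡ ℓ' j
  admissible-unique z {ℓ} {ℓ'} d d≤m∸t adm adm' high j = bit-injective agree
    where
    κ : Fin s → ℕ
    κ j = dualIndex z ℓ j ⊕ dualIndex z ℓ' j
    κ-high : ∀ j i → d j ≤ i → bit (κ j) i ≡ false
    κ-high j i d≤i = begin
      bit (κ j) i                       ≡⟨ bit-dualIndex-⊕ z ℓ ℓ' adm adm' j i ⟩
      bit (ℓ j) i xor bit (ℓ' j) i      ≡⟨ cong (_xor bit (ℓ' j) i) (high j i d≤i) ⟩
      bit (ℓ' j) i xor bit (ℓ' j) i     ≡⟨ xor-same (bit (ℓ' j) i) ⟩
      false                             ∎
      where open ≡-Reasoning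
    κ-low : ∀ j i → bit (κ j) i ≡ true → i < d j
    κ-low j i bit≡true with d j ≤? i
    ... | no  d≰i = ℕₚ.≰⇒> d≰i
    ... | yes d≤i with () ← trans (sym bit≡true) (κ-high j i d≤i)
    agree : ∀ i → bit (ℓ j) i ≡ bit (ℓ' j) i
    agree i with d j ≤? i
    ... | yes d≤i = high j i d≤i
    ... | no  d≰i = xor-≡false (trans (sym (bit-dualIndex-⊕ z ℓ ℓ' adm adm' j i))
          (dual-bits-vanish order2 t<2m κ light cols j i (ℕₚ.<-≤-trans i<d (ℕₚ.≤-trans d≤|d| (ℕₚ.≤-trans |d|≤m (ℕₚ.m≤m+n m _))))))
      where
      i<d = ℕₚ.≰⇒> d≰i
      d≤|d| = ≤-sumFinℕ s d j
      room = order2-applies m t (sumFinℕ s d) (ℕₚ.<-≤-trans (ℕₚ.≤-<-trans z≤n i<d) d≤|d|) d≤m∸t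
      t<2m = proj₁ room
      |d|≤m : sumFinℕ s d ≤ m
      |d|≤m = ℕₚ.≤-trans d≤m∸t (ℕₚ.m∸n≤m m t)
      light : sumFinℕ s (λ j → topSum 2 (bit (κ j)) (2 ℕ.* m)) + t ≤ 2 ℕ.* m
      light = ℕₚ.≤-trans (ℕₚ.+-monoˡ-≤ t (ℕₚ.≤-trans
        (sumFinℕ-mono s (λ j → topSum2-≤ (bit (κ j)) (2 ℕ.* m) (d j) (d j) ℕₚ.≤-refl (λ i _ b≡t → inj₂ (κ-low j i b≡t))))
        (ℕₚ.≤-reflexive (sumFinℕ-+ s d d)))) (proj₂ room)
      cols : ∀ col → col < m → columnSum C m κ col ≡ false
      cols col col<m = trans (columnSum-⊕ C m _ _ col)
        (cong₂ _xor_ (inDualStarᵇ⇒columnSum C m (admissible⇒dual z ℓ adm) col col<m)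
                     (inDualStarᵇ⇒columnSum C m (admissible⇒dual z ℓ' adm') col col<m))

  count : ℕ → (Fin s → ℕ) → ℚ
  count L z = boxSum s (λ _ → L) (λ ℓ → indicator (admissible z ℓ))

  -- Split each ℓ_j < 2^{b_j} into high digits q_j and d_j low digits r_j: by
  -- admissible-unique, q determines r.
  count-≤ : ∀ L z (d : Fin s → ℕ) → (∀ j → d j ≤ b j) → sumFinℕ s d ≤ m ∸ t →
    count L z ≤ℚ pow2 (sumFinℕ s (λ j → b j ∸ d j))
  count-≤ L z d d≤b d≤m∸t = begin
    count L z
      ≤⟨ boxSum-resize s _ (λ j → E j ℕ.* D j) (λ ℓ → 0≤indicator (admissible z ℓ)) support ⟩
    boxSum s (λ j → E j ℕ.* D j) f
      ≡⟨ boxSum-* s E D f (λ u v u≡v → cong indicator (admissible-cong z u v u≡v)) ⟩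
    boxSum s E (λ q → boxSum s D (λ r → f (block q r)))
      ≤⟨ boxSum-mono-≤ s E (λ q → boxSum-≤1 s D (λ r → indicator-≤1 _) (unique q)) ⟩
    boxSum s E (λ _ → 1ℚ)
      ≡⟨ boxSum-2^-1 s (λ j → b j ∸ d j) ⟩
    pow2 (sumFinℕ s (λ j → b j ∸ d j))
      ∎
    where
    open ℚₚ.≤-Reasoning
    E D : Fin s → ℕ
    E j = 2 ^ (b j ∸ d j)
    D j = 2 ^ d j
    f : (Fin s → ℕ) → ℚ
    f ℓ = indicator (admissible z ℓ)
    block : (Fin s → ℕ) → (Fin s → ℕ) → Fin s → ℕ
    block q r j = q j ℕ.* D j + r j
    2^b≡E*D : ∀ j → 2 ^ b j ≡ E j ℕ.* D j
    2^b≡E*D j = trans (cong (2 ^_) (sym (ℕₚ.m∸n+n≡m (d≤b j)))) (ℕₚ.^-distribˡ-+-* 2 (b j ∸ d j) (d j))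
    support : ∀ ℓ → InBox (λ _ → L) ℓ → f ℓ ≡ 0ℚ ⊎ InBox (λ j → E j ℕ.* D j) ℓ
    support ℓ _ with admissible z ℓ in adm
    ... | false = inj₁ refl
    ... | true  = inj₂ (λ j → subst (ℓ j <_) (2^b≡E*D j) (admissible⇒< z ℓ adm j))
    unique : ∀ q r r' → InBox D r → InBox D r' → ¬ f (block q r) ≡ 0ℚ → ¬ f (block q r') ≡ 0ℚ →
      ∀ j → r j ≡ r' j
    unique q r r' r∈D r'∈D fr≢0 fr'≢0 j = ℕₚ.+-cancelˡ-≡ (q j ℕ.* D j) (r j) (r' j)
      (admissible-unique z d d≤m∸t (indicator≢0 fr≢0) (indicator≢0 fr'≢0)
        (λ j i d≤i → trans (bit-block (d j) (q j) (r j) i (r∈D j) d≤i)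
                           (sym (bit-block (d j) (q j) (r' j) i (r'∈D j) d≤i))) j)

  innerSum≡ : ∀ L → innerSum C m b L ≡ boxSum s (λ _ → L) (λ z → pow2neg (norm1 z) * count L z)
  innerSum≡ L = begin
    innerSum C m b L
      ≡⟨ sumBox≡boxSum s L _ ⟩
    boxSum s (λ _ → L) (λ ℓ → if inBᵇ b ℓ then sumBox s L (λ z → if inDualStarᵇ C m (dualIndex z ℓ) then pow2neg (norm1 z) else 0ℚ) else 0ℚ)
      ≡⟨ boxSum-cong s _ (λ ℓ → pull ℓ (inBᵇ b ℓ)) ⟩
    boxSum s (λ _ → L) (λ ℓ → boxSum s (λ _ → L) (λ z → pow2neg (norm1 z) * indicator (admissible z ℓ)))
      ≡⟨ boxSum-comm s s _ _ (λ ℓ z → pow2neg (norm1 z) * indicator (admissible z ℓ)) ⟩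
    boxSum s (λ _ → L) (λ z → boxSum s (λ _ → L) (λ ℓ → pow2neg (norm1 z) * indicator (admissible z ℓ)))
      ≡⟨ boxSum-cong s _ (λ z → boxSum-*ˡ s _ (pow2neg (norm1 z)) _) ⟩
    boxSum s (λ _ → L) (λ z → pow2neg (norm1 z) * count L z)
      ∎
    where
    open ≡-Reasoning
    pull : ∀ ℓ c → (if c then sumBox s L (λ z → if inDualStarᵇ C m (dualIndex z ℓ) then pow2neg (norm1 z) else 0ℚ) else 0ℚ)
                 ≡ boxSum s (λ _ → L) (λ z → pow2neg (norm1 z) * indicator (c ∧ inDualStarᵇ C m (dualIndex z ℓ)))
    pull ℓ true  = trans (sumBox≡boxSum s L _) (boxSum-cong s _ (λ z → if-then-0 _ (pow2neg (norm1 z))))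
    pull ℓ false = sym (boxSum-≡0 s _ (λ z _ → ℚₚ.*-zeroʳ (pow2neg (norm1 z))))

  weighted-count-≤ : ∀ L z → pow2 m * pow2neg (norm1 b) * (pow2neg (norm1 z) * count L z) ≤ℚ pow2 t * ¾^ (norm1 z)
  weighted-count-≤ L z with 2 ℕ.* m ≤? norm1 z + (norm1 b + norm1 b) + t
  ... | yes heavy = weighted-≤-2^t*¾^ m (norm1 b) (norm1 z) e t
    (0≤boxSum s _ (λ ℓ → 0≤indicator (admissible z ℓ)))
    (count-≤ L z d (greedy-≤ s (m ∸ t) b) (ℕₚ.≤-trans (ℕₚ.≤-reflexive (sum-greedy s (m ∸ t) b)) (ℕₚ.m⊓n≤n _ _)))
    (2^[m+e]-bound-greedy m t (norm1 b) (norm1 z) e heavy e+|d|≡|b|)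
    where
    d = greedy s (m ∸ t) b
    e = sumFinℕ s (λ j → b j ∸ d j)
    e+|d|≡|b| : e + norm1 b ⊓ (m ∸ t) ≡ norm1 b
    e+|d|≡|b| = begin
      e + norm1 b ⊓ (m ∸ t)                ≡⟨ cong (λ w → e + w) (sym (sum-greedy s (m ∸ t) b)) ⟩
      e + sumFinℕ s d                      ≡⟨ sym (sumFinℕ-+ s (λ j → b j ∸ d j) d) ⟩
      sumFinℕ s (λ j → b j ∸ d j + d j)    ≡⟨ sumFinℕ-cong s (λ j → ℕₚ.m∸n+n≡m (greedy-≤ s (m ∸ t) b j)) ⟩
      norm1 b                              ∎
      where open ≡-Reasoning
  ... | no light = begin
    pow2 m * pow2neg (norm1 b) * (pow2neg (norm1 z) * count L z)
      ≡⟨ cong (λ w → pow2 m * pow2neg (norm1 b) * (pow2neg (norm1 z) * w)) count≡0 ⟩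
    pow2 m * pow2neg (norm1 b) * (pow2neg (norm1 z) * 0ℚ)
      ≡⟨ trans (cong (pow2 m * pow2neg (norm1 b) *_) (ℚₚ.*-zeroʳ (pow2neg (norm1 z))))
               (ℚₚ.*-zeroʳ (pow2 m * pow2neg (norm1 b))) ⟩
    0ℚ
      ≤⟨ 0≤* (0≤toℚ (2 ^ t)) (0≤¾^ (norm1 z)) ⟩
    pow2 t * ¾^ (norm1 z)
      ∎
    where
    open ℚₚ.≤-Reasoning
    count≡0 : count L z ≡ 0ℚ
    count≡0 = boxSum-≡0 s _ λ ℓ _ → nonadmissible ℓ (admissible z ℓ) refl
      where
      nonadmissible : ∀ ℓ c → admissible z ℓ ≡ c → indicator c ≡ 0ℚ
      nonadmissible ℓ false _   = refl
      nonadmissible ℓ true  adm = ⊥-elim (light (admissible⇒heavy z ℓ adm))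

  scaledInnerSum-≤ : ∀ L → pow2 m * pow2neg (norm1 b) * innerSum C m b L ≤ℚ pow2 t * toℚ (4 ^ s)
  scaledInnerSum-≤ L = begin
    pow2 m * pow2neg (norm1 b) * innerSum C m b L
      ≡⟨ cong (pow2 m * pow2neg (norm1 b) *_) (innerSum≡ L) ⟩
    pow2 m * pow2neg (norm1 b) * boxSum s (λ _ → L) (λ z → pow2neg (norm1 z) * count L z)
      ≡⟨ sym (boxSum-*ˡ s _ (pow2 m * pow2neg (norm1 b)) (λ z → pow2neg (norm1 z) * count L z)) ⟩
    boxSum s (λ _ → L) (λ z → pow2 m * pow2neg (norm1 b) * (pow2neg (norm1 z) * count L z))
      ≤⟨ boxSum-mono-≤ s _ (weighted-count-≤ L) ⟩
    boxSum s (λ _ → L) (λ z → pow2 t * ¾^ (norm1 z))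
      ≡⟨ boxSum-*ˡ s _ (pow2 t) _ ⟩
    pow2 t * boxSum s (λ _ → L) (λ z → ¾^ (norm1 z))
      ≤⟨ *-monoʳ-≤-0≤ (pow2 t) (0≤toℚ (2 ^ t)) (boxSum-¾^ s L) ⟩
    pow2 t * toℚ (4 ^ s)
      ∎
    where open ℚₚ.≤-Reasoning

outerSum-≤ : ∀ {s t C} → IsOrder2DigitalSeq s t C → ∀ ms b L →
  outerSum C ms b L ≤ℚ (pow2 t * toℚ (4 ^ s)) * toℚ (length ms)
outerSum-≤ {s} {t} order2 []       b L = ℚₚ.≤-reflexive (sym (ℚₚ.*-zeroʳ (pow2 t * toℚ (4 ^ s))))
outerSum-≤ {s} {t} {C} order2 (m ∷ ms) b L = begin
  pow2 m * pow2neg (norm1 b) * innerSum C m b L ℚ.+ outerSum C ms b L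
    ≤⟨ ℚₚ.+-mono-≤ (Counting.scaledInnerSum-≤ order2 m b L) (outerSum-≤ order2 ms b L) ⟩
  K ℚ.+ K * toℚ (length ms)
    ≡⟨ cong (ℚ._+ K * toℚ (length ms)) (sym (ℚₚ.*-identityʳ K)) ⟩
  K * 1ℚ ℚ.+ K * toℚ (length ms)
    ≡⟨ sym (ℚₚ.*-distribˡ-+ K 1ℚ (toℚ (length ms))) ⟩
  K * (1ℚ ℚ.+ toℚ (length ms))
    ≡⟨ cong (K *_) (toℚ-+ 1 (length ms)) ⟩
  K * toℚ (suc (length ms))
    ∎
  where
  open ℚₚ.≤-Reasoning
  K = pow2 t * toℚ (4 ^ s)

0<2^t*4^s : ∀ s t → 0ℚ <ℚ pow2 t * toℚ (4 ^ s)
0<2^t*4^s s t = ℚₚ.<-≤-trans (ℚₚ.positive⁻¹ 1ℚ) (begin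
  toℚ 1                        ≤⟨ toℚ-mono-≤ (ℕₚ.*-mono-≤ (ℕₚ.m^n>0 2 t) (ℕₚ.m^n>0 4 s)) ⟩
  toℚ (2 ^ t ℕ.* 4 ^ s)        ≡⟨ sym (toℚ-* (2 ^ t) (4 ^ s)) ⟩
  pow2 t * toℚ (4 ^ s)         ∎)
  where open ℚₚ.≤-Reasoning

lemma7 : (s t : ℕ) → 1 ≤ s →
    Σ ℚ (λ K → 0ℚ <ℚ K ×
      ((C : Matrices s) → IsOrder2DigitalSeq s t C →
       (N : ℕ) (ms : List ℕ) → Linked _>_ ms → N ≡ sum (map (2 ^_) ms) → 2 ≤ N →
       (b : Fin s → ℕ) (L : ℕ) →
       outerSum C ms b L ≤ℚ K * ((+ length ms) / 1)))
lemma7 s t _ = pow2 t * toℚ (4 ^ s) , 0<2^t*4^s s t , λ C order2 _ ms _ _ _ b L → outerSum-≤ order2 ms b L
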